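{- Let $n\geq 5$ be odd, let $C_{2n}$ be the cycle with nodes $v_0,\dots,v_{2n-1}$ and edges $j=v_jv_{(j+1)\bmod 2n}$ for $0\leq j<2n$ (edge indices taken modulo $2n$), and let $S=\{\{v_i,v_{(i+n)\bmod 2n}\}:1\leq i\leq n\}$. Then for $\beta\in\{1,2\}$ and $\beta'=3-\beta$, the inequality $$\sum_{i=0}^{n-1}(\beta x_{2i-1}+\beta' x_{2i})\geq 3$$ defines a shared facet of $\mathrm{MultC}(C_{2n},S)$.
   Context: Given a graph $G=(V,E)$ and $S\subseteq\binom{V}{2}$, an ($S$-)multicut is a set $\delta\subseteq E$ such that for every $\{s,t\}\in S$ the nodes $s$ and $t$ lie in different components of $G-\delta$. For $F\subseteq E$, $x^F\in\mathbb{R}^E$ is its incidence vector. The multicut polytope is $\mathrm{MultC}^{\square}(G,S)=\mathrm{conv}\{x^\delta:\delta\text{ an } S\text{ -multicut}\}$ and the multicut dominant is $\mathrm{MultC}(G,S)=\mathrm{MultC}^{\square}(G,S)+\mathbb{R}^E_{\geq 0}$. A facet-defining inequality of $\mathrm{MultC}(G,S)$ defines a shared facet if it is also facet-defining for $\mathrm{MultC}^{\square}(G,S)$. -}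

module Defs where

open import Data.Nat as ℕ using (ℕ; zero; suc; NonZero)
open import Data.Nat.DivMod using (_mod_)
open import Data.Fin using (Fin; zero; suc)
open import Data.Bool using (Bool; true; false; if_then_else_)
open import Data.Product using (Σ; ∃; ∃-syntax; _×_; _,_)
open import Data.Sum using (_⊎_)
open import Data.Integer using (+_)
open import Data.Rational using (ℚ; 0ℚ; 1ℚ; _+_; _*_; _≤_; _/_)
open import Relation.Binary.PropositionalEquality using (_≡_)
open import Relation.Nullary using (¬_)

Σᶠ : ∀ {k} → (Fin k → ℚ) → ℚ
Σᶠ {zero}  f = 0ℚ
Σᶠ {suc k} f = f zero + Σᶠ (λ i → f (suc i))

_·_ : ∀ {m} → (Fin m → ℚ) → (Fin m → ℚ) → ℚ
a · x = Σᶠ (λ e → a e * x e)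

lincomb : ∀ {k m} → (Fin k → ℚ) → (Fin k → Fin m → ℚ) → Fin m → ℚ
lincomb λs ps e = Σᶠ (λ i → λs i * ps i e)

Region : ℕ → Set₁
Region m = (Fin m → ℚ) → Set

AffinelyIndependent : ∀ {k m} → (Fin k → Fin m → ℚ) → Set
AffinelyIndependent {k} {m} ps =
  (λs : Fin k → ℚ) → Σᶠ λs ≡ 0ℚ → (∀ e → lincomb λs ps e ≡ 0ℚ) → ∀ i → λs i ≡ 0ℚ

HasDim : ∀ {m} → Region m → ℕ → Set
HasDim {m} P d =
  (Σ (Fin (suc d) → Fin m → ℚ) λ ps → (∀ i → P (ps i)) × AffinelyIndependent ps)
  × ((ps : Fin (suc (suc d)) → Fin m → ℚ) → (∀ i → P (ps i)) → ¬ AffinelyIndependent ps)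

Valid : ∀ {m} → Region m → (Fin m → ℚ) → ℚ → Set
Valid P a b = ∀ x → P x → b ≤ a · x

Face : ∀ {m} → Region m → (Fin m → ℚ) → ℚ → Region m
Face P a b x = P x × (a · x ≡ b)

FacetDefining : ∀ {m} → Region m → (Fin m → ℚ) → ℚ → Set
FacetDefining P a b =
  Valid P a b × Σ ℕ (λ d → HasDim P (suc d) × HasDim (Face P a b) d)

record Graph : Set where
  field
    nV   : ℕ
    nE   : ℕ
    ends : Fin nE → Fin nV × Fin nV

open Graph public

EdgeSet : Graph → Set
EdgeSet G = Fin (nE G) → Bool

data Reach (G : Graph) (δ : EdgeSet G) (u : Fin (nV G)) : Fin (nV G) → Set where
  here : Reach G δ u u
  step : ∀ {w w'} → Reach G δ u w → (e : Fin (nE G)) → δ e ≡ false →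
         (ends G e ≡ (w , w') ⊎ ends G e ≡ (w' , w)) → Reach G δ u w'

PairSet : Graph → Set₁
PairSet G = Fin (nV G) → Fin (nV G) → Set

IsMulticut : (G : Graph) → PairSet G → EdgeSet G → Set
IsMulticut G S δ = ∀ s t → S s t → ¬ Reach G δ s t

incidence : (G : Graph) → EdgeSet G → Fin (nE G) → ℚ
incidence G δ e = if δ e then 1ℚ else 0ℚ

MultCBox : (G : Graph) → PairSet G → Region (nE G)
MultCBox G S x =
  Σ ℕ λ k → Σ (Fin k → ℚ) λ λs → Σ (Fin k → EdgeSet G) λ δs →
    (∀ i → 0ℚ ≤ λs i) × (Σᶠ λs ≡ 1ℚ) × (∀ i → IsMulticut G S (δs i))
    × (∀ e → x e ≡ lincomb λs (λ i → incidence G (δs i)) e)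

-- multicut dominant MultC(G,S) = MultC^□(G,S) + ℝ^E_{≥0}
MultC : (G : Graph) → PairSet G → Region (nE G)
MultC G S x = Σ (Fin (nE G) → ℚ) λ y → MultCBox G S y × (∀ e → y e ≤ x e)

SharedFacet : (G : Graph) → PairSet G → (Fin (nE G) → ℚ) → ℚ → Set
SharedFacet G S a b = FacetDefining (MultC G S) a b × FacetDefining (MultCBox G S) a b

Odd : ℕ → Set
Odd n = ∃[ k ] n ≡ suc (2 ℕ.* k)

nz2n : ∀ n → 5 ℕ.≤ n → NonZero (2 ℕ.* n)
nz2n (suc n) _ = _

md : ∀ n → 5 ℕ.≤ n → ℕ → Fin (2 ℕ.* n)
md n hn k = _mod_ k (2 ℕ.* n) {{nz2n n hn}}

C : ∀ n → 5 ℕ.≤ n → Graph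
C n hn = record { nV = 2 ℕ.* n ; nE = 2 ℕ.* n
                ; ends = λ j → (j , md n hn (suc (Data.Fin.toℕ j))) }

Sᶜ : ∀ n → (hn : 5 ℕ.≤ n) → PairSet (C n hn)
Sᶜ n hn s t = ∃[ i ] (1 ℕ.≤ i × i ℕ.≤ n × s ≡ md n hn i × t ≡ md n hn (i ℕ.+ n))

ℕ→ℚ : ℕ → ℚ
ℕ→ℚ k = + k / 1

-- coefficient vector of  Σ_{i=0}^{n-1} (β x_{2i-1} + β' x_{2i}), indices mod 2n
-- (2i-1 mod 2n is written as (2i + 2n - 1) mod 2n to stay in ℕ)
coeffs : ∀ n → (hn : 5 ℕ.≤ n) → ℕ → ℕ → Fin (2 ℕ.* n) → ℚ
coeffs n hn β β' e =
  Σᶠ {n} λ i →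
    let i' = Data.Fin.toℕ i in
    (if ⌊ Data.Fin._≟_ e (md n hn (2 ℕ.* i' ℕ.+ 2 ℕ.* n ℕ.∸ 1)) ⌋ then ℕ→ℚ β else 0ℚ)
    + (if ⌊ Data.Fin._≟_ e (md n hn (2 ℕ.* i')) ⌋ then ℕ→ℚ β' else 0ℚ)
  where open import Relation.Nullary.Decidable using (⌊_⌋)

-- Let n = 2h + 1 and call the edges of weight 1 cheap, those of weight 2 expensive; they alternate
-- around the cycle.  A multicut must cut every arc of n consecutive edges, since the two ends of such
-- an arc form a pair of S.  So it cuts at least two edges, and has weight below 3 only if it cuts
-- exactly two cheap ones; but these are an even distance apart, never n, so some such arc misses both.
-- Hence every multicut, and so every point of the polytope and of the dominant, has weight at least 3.
-- For the facet, take the n multicuts {e, e + n} with e expensive and n multicuts by three cheap edges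
-- whose cyclic gaps are at most n; all have weight 3.  Together with the set of all edges they are
-- affinely independent: each comes with a linear functional that is nonzero on it but constant
-- (0, or 3 for the weights) on every later one, so the 2n + 1 points are triangular.

module Submission where

open import Defs
import Data.Nat as ℕ
import Data.Fin as Fin
import Data.Rational as ℚ
open import Relation.Binary.PropositionalEquality using (_≡_)

module FiniteSums where

  open import Data.Nat using (zero; suc)
  open import Data.Fin using (Fin; zero; suc; _≟_)
  open import Data.Fin.Properties using (suc-injective)
  open import Data.Rational using (ℚ; 0ℚ; _+_; _*_; _≤_)
  open import Data.Rational.Properties hiding (_≟_)
  open import Data.Bool using (if_then_else_)
  open import Data.Empty using (⊥-elim)
  open import Relation.Nullary using (yes; no)
  open import Relation.Nullary.Decidable using (⌊_⌋)
  open import Relation.Binary.PropositionalEquality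
  open import Algebra.Bundles using (CommutativeRing; CommutativeMonoid)
  open import Algebra.Properties.CommutativeSemigroup
    (CommutativeMonoid.commutativeSemigroup +-0-commutativeMonoid) using (x∙yz≈y∙xz)
  open import Algebra.Properties.Semiring.Sum (CommutativeRing.semiring +-*-commutativeRing)
    using (sum; sum-cong-≗; sum-replicate-zero; ∑-distrib-+; ∑-comm; *-distribˡ-sum)

  Σᶠ≡sum : ∀ {k} (f : Fin k → ℚ) → Σᶠ f ≡ sum f
  Σᶠ≡sum {zero}  f = refl
  Σᶠ≡sum {suc k} f = cong (f zero +_) (Σᶠ≡sum (λ i → f (suc i)))

  Σᶠ-cong : ∀ {k} {f g : Fin k → ℚ} → (∀ i → f i ≡ g i) → Σᶠ f ≡ Σᶠ g
  Σᶠ-cong {f = f} {g} f≗g = trans (Σᶠ≡sum f) (trans (sum-cong-≗ {x = f} {y = g} f≗g) (sym (Σᶠ≡sum g)))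

  Σᶠ-zero : ∀ {k} (f : Fin k → ℚ) → (∀ i → f i ≡ 0ℚ) → Σᶠ f ≡ 0ℚ
  Σᶠ-zero {k} f f≗0 = trans (Σᶠ-cong f≗0) (trans (Σᶠ≡sum {k} (λ _ → 0ℚ)) (sum-replicate-zero k))

  Σᶠ-+ : ∀ {k} (f g : Fin k → ℚ) → Σᶠ (λ i → f i + g i) ≡ Σᶠ f + Σᶠ g
  Σᶠ-+ f g = begin
    Σᶠ (λ i → f i + g i)  ≡⟨ Σᶠ≡sum (λ i → f i + g i) ⟩
    sum (λ i → f i + g i) ≡⟨ ∑-distrib-+ f g ⟩
    sum f + sum g         ≡⟨ sym (cong₂ _+_ (Σᶠ≡sum f) (Σᶠ≡sum g)) ⟩
    Σᶠ f + Σᶠ g           ∎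
    where open ≡-Reasoning

  Σᶠ-*ˡ : ∀ {k} (c : ℚ) (f : Fin k → ℚ) → Σᶠ (λ i → c * f i) ≡ c * Σᶠ f
  Σᶠ-*ˡ c f = trans (Σᶠ≡sum (λ i → c * f i)) (sym (trans (cong (c *_) (Σᶠ≡sum f)) (*-distribˡ-sum c f)))

  Σᶠ-comm : ∀ {k l} (f : Fin k → Fin l → ℚ) →
            Σᶠ (λ i → Σᶠ (λ j → f i j)) ≡ Σᶠ (λ j → Σᶠ (λ i → f i j))
  Σᶠ-comm f = begin
    Σᶠ (λ i → Σᶠ (λ j → f i j))    ≡⟨ Σᶠ-cong (λ i → Σᶠ≡sum (f i)) ⟩
    Σᶠ (λ i → sum (λ j → f i j))   ≡⟨ Σᶠ≡sum (λ i → sum (f i)) ⟩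
    sum (λ i → sum (λ j → f i j))  ≡⟨ ∑-comm f ⟩
    sum (λ j → sum (λ i → f i j))  ≡⟨ Σᶠ≡sum (λ j → sum (λ i → f i j)) ⟨
    Σᶠ (λ j → sum (λ i → f i j))   ≡⟨ Σᶠ-cong (λ j → Σᶠ≡sum (λ i → f i j)) ⟨
    Σᶠ (λ j → Σᶠ (λ i → f i j))    ∎
    where open ≡-Reasoning

  Σᶠ-mono-≤ : ∀ {k} {f g : Fin k → ℚ} → (∀ i → f i ≤ g i) → Σᶠ f ≤ Σᶠ g
  Σᶠ-mono-≤ {zero}  f≤g = ≤-refl
  Σᶠ-mono-≤ {suc k} f≤g = +-mono-≤ (f≤g zero) (Σᶠ-mono-≤ (λ i → f≤g (suc i)))

  zeroAt : ∀ {k} → Fin k → (Fin k → ℚ) → Fin k → ℚ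
  zeroAt i f j = if ⌊ j ≟ i ⌋ then 0ℚ else f j

  zeroAt-≡ : ∀ {k} (i : Fin k) f → zeroAt i f i ≡ 0ℚ
  zeroAt-≡ i f with i ≟ i
  ... | yes _  = refl
  ... | no i≢i = ⊥-elim (i≢i refl)

  zeroAt-≢ : ∀ {k} {i j : Fin k} f → j ≢ i → zeroAt i f j ≡ f j
  zeroAt-≢ {i = i} {j} f j≢i with j ≟ i
  ... | yes j≡i = ⊥-elim (j≢i j≡i)
  ... | no _    = refl

  zeroAt-nonNeg : ∀ {k} (i : Fin k) {f} → (∀ j → 0ℚ ≤ f j) → ∀ j → 0ℚ ≤ zeroAt i f j
  zeroAt-nonNeg i f≥0 j with j ≟ i
  ... | yes _ = ≤-refl
  ... | no _  = f≥0 j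

  Σᶠ-extract : ∀ {k} (f : Fin k → ℚ) (i : Fin k) → Σᶠ f ≡ f i + Σᶠ (zeroAt i f)
  Σᶠ-extract {suc k} f zero = cong (f zero +_) (begin
    Σᶠ (λ j → f (suc j))              ≡⟨ Σᶠ-cong (λ j → sym (zeroAt-≢ {i = zero} {suc j} f (λ ()))) ⟩
    rest                              ≡⟨ sym (+-identityˡ rest) ⟩
    0ℚ + rest                         ≡⟨ cong (_+ rest) (sym (zeroAt-≡ zero f)) ⟩
    zeroAt zero f zero + rest         ∎)
    where
    open ≡-Reasoning
    rest : ℚ
    rest = Σᶠ (λ j → zeroAt zero f (suc j))
  Σᶠ-extract {suc k} f (suc i) = begin
    f zero + Σᶠ (λ j → f (suc j))                              ≡⟨ cong (f zero +_) (Σᶠ-extract (λ j → f (suc j)) i) ⟩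
    f zero + (f (suc i) + Σᶠ (zeroAt i (λ j → f (suc j))))     ≡⟨ x∙yz≈y∙xz (f zero) (f (suc i)) _ ⟩
    f (suc i) + (f zero + Σᶠ (zeroAt i (λ j → f (suc j))))     ≡⟨ cong (f (suc i) +_) (cong₂ _+_
                                                                    (sym (zeroAt-≢ {i = suc i} {zero} f (λ ())))
                                                                    (Σᶠ-cong zeroAt-suc)) ⟩
    f (suc i) + Σᶠ (zeroAt (suc i) f)                          ∎
    where
    open ≡-Reasoning
    zeroAt-suc : ∀ j → zeroAt i (λ j → f (suc j)) j ≡ zeroAt (suc i) f (suc j)
    zeroAt-suc j with j ≟ i | suc j ≟ suc i
    ... | yes _   | yes _   = refl
    ... | no _    | no _    = refl
    ... | yes j≡i | no sj≢si = ⊥-elim (sj≢si (cong suc j≡i))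
    ... | no j≢i  | yes sj≡si = ⊥-elim (j≢i (suc-injective sj≡si))

  Σᶠ-single : ∀ {k} (f : Fin k → ℚ) (i : Fin k) → (∀ j → j ≢ i → f j ≡ 0ℚ) → Σᶠ f ≡ f i
  Σᶠ-single f i f≗0 = begin
    Σᶠ f                   ≡⟨ Σᶠ-extract f i ⟩
    f i + Σᶠ (zeroAt i f)  ≡⟨ cong (f i +_) (Σᶠ-zero (zeroAt i f) vanish) ⟩
    f i + 0ℚ               ≡⟨ +-identityʳ (f i) ⟩
    f i                    ∎
    where
    open ≡-Reasoning
    vanish : ∀ j → zeroAt i f j ≡ 0ℚ
    vanish j with j ≟ i
    ... | yes _   = refl
    ... | no j≢i  = f≗0 j j≢i

  Σᶠ-pair : ∀ {k} (f : Fin k → ℚ) (u v : Fin k) → u ≢ v →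
            (∀ j → j ≢ u → j ≢ v → f j ≡ 0ℚ) → Σᶠ f ≡ f u + f v
  Σᶠ-pair f u v u≢v f≗0 = trans (Σᶠ-extract f u) (cong (f u +_)
    (trans (Σᶠ-single (zeroAt u f) v vanish) (zeroAt-≢ f (λ v≡u → u≢v (sym v≡u)))))
    where
    vanish : ∀ j → j ≢ v → zeroAt u f j ≡ 0ℚ
    vanish j j≢v with j ≟ u
    ... | yes _   = refl
    ... | no j≢u  = f≗0 j j≢u j≢v

  Σᶠ-triple : ∀ {k} (f : Fin k → ℚ) (u v w : Fin k) → u ≢ v → u ≢ w → v ≢ w →
              (∀ j → j ≢ u → j ≢ v → j ≢ w → f j ≡ 0ℚ) → Σᶠ f ≡ f u + (f v + f w)
  Σᶠ-triple f u v w u≢v u≢w v≢w f≗0 = trans (Σᶠ-extract f u) (cong (f u +_)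
    (trans (Σᶠ-pair (zeroAt u f) v w v≢w vanish)
           (cong₂ _+_ (zeroAt-≢ f (λ v≡u → u≢v (sym v≡u))) (zeroAt-≢ f (λ w≡u → u≢w (sym w≡u))))))
    where
    vanish : ∀ j → j ≢ v → j ≢ w → zeroAt u f j ≡ 0ℚ
    vanish j j≢v j≢w with j ≟ u
    ... | yes _   = refl
    ... | no j≢u  = f≗0 j j≢u j≢v j≢w

  Σᶠ-nonNeg : ∀ {k} {f : Fin k → ℚ} → (∀ i → 0ℚ ≤ f i) → 0ℚ ≤ Σᶠ f
  Σᶠ-nonNeg {k} f≥0 = ≤-trans (≤-reflexive (sym (Σᶠ-zero {k} (λ _ → 0ℚ) (λ _ → refl)))) (Σᶠ-mono-≤ f≥0)

  term≤Σᶠ : ∀ {k} {f : Fin k → ℚ} (u : Fin k) → (∀ j → 0ℚ ≤ f j) → f u ≤ Σᶠ f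
  term≤Σᶠ {f = f} u f≥0 = begin
    f u                     ≡⟨ sym (+-identityʳ (f u)) ⟩
    f u + 0ℚ                ≤⟨ +-monoʳ-≤ (f u) (Σᶠ-nonNeg (zeroAt-nonNeg u f≥0)) ⟩
    f u + Σᶠ (zeroAt u f)   ≡⟨ sym (Σᶠ-extract f u) ⟩
    Σᶠ f                    ∎
    where open ≤-Reasoning

  two-terms≤Σᶠ : ∀ {k} {f : Fin k → ℚ} (u v : Fin k) → u ≢ v → (∀ j → 0ℚ ≤ f j) → f u + f v ≤ Σᶠ f
  two-terms≤Σᶠ {f = f} u v u≢v f≥0 = begin
    f u + f v                ≡⟨ cong (f u +_) (sym (zeroAt-≢ f (λ v≡u → u≢v (sym v≡u)))) ⟩
    f u + zeroAt u f v       ≤⟨ +-monoʳ-≤ (f u) (term≤Σᶠ v (zeroAt-nonNeg u f≥0)) ⟩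
    f u + Σᶠ (zeroAt u f)    ≡⟨ sym (Σᶠ-extract f u) ⟩
    Σᶠ f                     ∎
    where open ≤-Reasoning

  three-terms≤Σᶠ : ∀ {k} {f : Fin k → ℚ} (u v w : Fin k) → u ≢ v → u ≢ w → v ≢ w →
                   (∀ j → 0ℚ ≤ f j) → f u + (f v + f w) ≤ Σᶠ f
  three-terms≤Σᶠ {f = f} u v w u≢v u≢w v≢w f≥0 = begin
    f u + (f v + f w)                     ≡⟨ cong (f u +_) (sym (cong₂ _+_ (zeroAt-≢ f (λ v≡u → u≢v (sym v≡u)))
                                                                          (zeroAt-≢ f (λ w≡u → u≢w (sym w≡u))))) ⟩
    f u + (zeroAt u f v + zeroAt u f w)   ≤⟨ +-monoʳ-≤ (f u) (two-terms≤Σᶠ v w v≢w (zeroAt-nonNeg u f≥0)) ⟩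
    f u + Σᶠ (zeroAt u f)                 ≡⟨ sym (Σᶠ-extract f u) ⟩
    Σᶠ f                                  ∎
    where open ≤-Reasoning

module LinearAlgebra where

  open import Data.Nat as ℕ using (zero; suc)
  open import Data.Nat.Properties as ℕ using ()
  open import Data.Fin using (Fin; zero; suc; punchIn; punchOut; _≟_)
  open import Data.Fin.Properties using (any?; punchIn-punchOut)
  open import Data.Rational using (ℚ; 0ℚ; 1ℚ; _+_; _*_; _-_; -_; 1/_; _≤_; ≢-nonZero; nonNegative)
  open import Data.Rational.Properties renaming (_≟_ to _≟₀_)
  open import Data.Product using (Σ; ∃; _×_; _,_; proj₂)
  open import Data.Empty using (⊥-elim)
  open import Relation.Nullary using (¬_; yes; no; ¬?)
  open import Relation.Binary.PropositionalEquality
  open import Data.Nat.Induction using (<-rec)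
  open import Data.Rational.Solver using (module +-*-Solver)
  open +-*-Solver using (solve; _:+_; _:*_; _:-_; :-_; _:=_; con)
  open FiniteSums

  ·-lincomb : ∀ {k m} (a : Fin m → ℚ) (λs : Fin k → ℚ) (ps : Fin k → Fin m → ℚ) →
              a · lincomb λs ps ≡ Σᶠ (λ i → λs i * (a · ps i))
  ·-lincomb a λs ps = begin
    Σᶠ (λ e → a e * Σᶠ (λ i → λs i * ps i e))
      ≡⟨ Σᶠ-cong (λ e → sym (Σᶠ-*ˡ (a e) (λ i → λs i * ps i e))) ⟩
    Σᶠ (λ e → Σᶠ (λ i → a e * (λs i * ps i e)))
      ≡⟨ Σᶠ-comm (λ e i → a e * (λs i * ps i e)) ⟩
    Σᶠ (λ i → Σᶠ (λ e → a e * (λs i * ps i e)))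
      ≡⟨ Σᶠ-cong (λ i → Σᶠ-cong (λ e → x[yz]≡y[xz] (a e) (λs i) (ps i e))) ⟩
    Σᶠ (λ i → Σᶠ (λ e → λs i * (a e * ps i e)))
      ≡⟨ Σᶠ-cong (λ i → Σᶠ-*ˡ (λs i) (λ e → a e * ps i e)) ⟩
    Σᶠ (λ i → λs i * (a · ps i))
      ∎
    where
    open ≡-Reasoning
    x[yz]≡y[xz] : ∀ x y z → x * (y * z) ≡ y * (x * z)
    x[yz]≡y[xz] = solve 3 (λ x y z → x :* (y :* z) := y :* (x :* z)) refl

  ·-zeroʳ : ∀ {m} (a x : Fin m → ℚ) → (∀ e → x e ≡ 0ℚ) → a · x ≡ 0ℚ
  ·-zeroʳ a x x≗0 = Σᶠ-zero _ (λ e → trans (cong (a e *_) (x≗0 e)) (*-zeroʳ (a e)))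

  *-cancelʳ-≡0 : ∀ (x d : ℚ) → d ≢ 0ℚ → x * d ≡ 0ℚ → x ≡ 0ℚ
  *-cancelʳ-≡0 x d d≢0 xd≡0 = begin
    x                 ≡⟨ sym (*-identityʳ x) ⟩
    x * 1ℚ            ≡⟨ cong (x *_) (sym (*-inverseʳ d)) ⟩
    x * (d * 1/ d)    ≡⟨ sym (*-assoc x d (1/ d)) ⟩
    (x * d) * 1/ d    ≡⟨ cong (_* 1/ d) xd≡0 ⟩
    0ℚ * 1/ d         ≡⟨ *-zeroˡ (1/ d) ⟩
    0ℚ                ∎
    where
    open ≡-Reasoning
    instance _ = ≢-nonZero d≢0

  ·-mono-≤ : ∀ {m} (a : Fin m → ℚ) {x y : Fin m → ℚ} → (∀ e → 0ℚ ≤ a e) → (∀ e → x e ≤ y e) →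
             a · x ≤ a · y
  ·-mono-≤ a a≥0 x≤y = Σᶠ-mono-≤ (λ e → *-monoˡ-≤-nonNeg (a e) {{nonNegative (a≥0 e)}} (x≤y e))

  convexCombination-≥ : ∀ {k m} (a : Fin m → ℚ) (b : ℚ) (λs : Fin k → ℚ) (ps : Fin k → Fin m → ℚ) →
                        (∀ i → 0ℚ ≤ λs i) → Σᶠ λs ≡ 1ℚ → (∀ i → b ≤ a · ps i) → b ≤ a · lincomb λs ps
  convexCombination-≥ a b λs ps λ≥0 Σλ≡1 b≤ = begin
    b                              ≡⟨ sym (*-identityʳ b) ⟩
    b * 1ℚ                         ≡⟨ cong (b *_) (sym Σλ≡1) ⟩
    b * Σᶠ λs                      ≡⟨ sym (Σᶠ-*ˡ b λs) ⟩
    Σᶠ (λ i → b * λs i)            ≤⟨ Σᶠ-mono-≤ (λ i → ≤-trans (≤-reflexive (*-comm b (λs i)))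
                                        (*-monoˡ-≤-nonNeg (λs i) {{nonNegative (λ≥0 i)}} (b≤ i))) ⟩
    Σᶠ (λ i → λs i * (a · ps i))   ≡⟨ sym (·-lincomb a λs ps) ⟩
    a · lincomb λs ps              ∎
    where open ≤-Reasoning

  ·-comm : ∀ {m} (a x : Fin m → ℚ) → a · x ≡ x · a
  ·-comm a x = Σᶠ-cong (λ e → *-comm (a e) (x e))

  lincomb-· : ∀ {k m} (λs : Fin k → ℚ) (ps : Fin k → Fin m → ℚ) (x : Fin m → ℚ) →
              lincomb λs ps · x ≡ Σᶠ (λ i → λs i * (ps i · x))
  lincomb-· λs ps x = trans (·-comm (lincomb λs ps) x)
                            (trans (·-lincomb x λs ps) (Σᶠ-cong (λ i → cong (λs i *_) (·-comm x (ps i)))))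

  NontrivialSolution : ∀ {e k} → (Fin e → Fin k → ℚ) → Set
  NontrivialSolution {e} {k} M =
    Σ (Fin k → ℚ) λ v → (∃ λ i → v i ≢ 0ℚ) × (∀ r → Σᶠ (λ j → M r j * v j) ≡ 0ℚ)

  zeroColumn-solution : ∀ {e k} (M : Fin e → Fin (suc k) → ℚ) → (∀ r → M r zero ≡ 0ℚ) →
                        NontrivialSolution M
  zeroColumn-solution {k = k} M col≡0 = v , (zero , λ ()) , rows
    where
    v : Fin (suc k) → ℚ
    v zero    = 1ℚ
    v (suc j) = 0ℚ
    rows : ∀ r → Σᶠ (λ j → M r j * v j) ≡ 0ℚ
    rows r = cong₂ _+_ (trans (*-identityʳ _) (col≡0 r))
                       (Σᶠ-zero {k} (λ j → M r (suc j) * 0ℚ) (λ j → *-zeroʳ (M r (suc j))))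

  module Pivot {e k} (M : Fin (suc e) → Fin (suc k) → ℚ) (r₀ : Fin (suc e)) (M₀≢0 : M r₀ zero ≢ 0ℚ) where

    instance _ = ≢-nonZero M₀≢0

    factor : Fin e → ℚ
    factor r = M (punchIn r₀ r) zero * 1/ M r₀ zero

    eliminated : Fin e → Fin k → ℚ
    eliminated r j = M (punchIn r₀ r) (suc j) - factor r * M r₀ (suc j)

    backSubstitute : NontrivialSolution eliminated → NontrivialSolution M
    backSubstitute (v′ , (i , v′i≢0) , rows′) = v , (suc i , v′i≢0) , rows
      where
      s : ℚ
      s = Σᶠ (λ j → M r₀ (suc j) * v′ j)
      v : Fin (suc k) → ℚ
      v zero    = - (s * 1/ M r₀ zero)
      v (suc j) = v′ j
      pivotRow : Σᶠ (λ j → M r₀ j * v j) ≡ 0ℚ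
      pivotRow = begin
        M r₀ zero * - (s * 1/ M r₀ zero) + s
          ≡⟨ solve 3 (λ d s d⁻¹ → d :* (:- (s :* d⁻¹)) :+ s := s :- s :* (d :* d⁻¹)) refl (M r₀ zero) s (1/ M r₀ zero) ⟩
        s - s * (M r₀ zero * 1/ M r₀ zero)     ≡⟨ cong (λ t → s - s * t) (*-inverseʳ (M r₀ zero)) ⟩
        s - s * 1ℚ                             ≡⟨ cong (λ t → s - t) (*-identityʳ s) ⟩
        s - s                                  ≡⟨ +-inverseʳ s ⟩
        0ℚ                                     ∎
        where open ≡-Reasoning
      otherRow : ∀ r → Σᶠ (λ j → M (punchIn r₀ r) j * v j) ≡ 0ℚ
      otherRow r = begin
        R zero * v zero + Σᶠ (λ j → R (suc j) * v′ j)
          ≡⟨ cong (R zero * v zero +_) (Σᶠ-cong (λ j → split (R (suc j)) (factor r) (M r₀ (suc j)) (v′ j))) ⟩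
        R zero * v zero + Σᶠ (λ j → eliminated r j * v′ j + factor r * (M r₀ (suc j) * v′ j))
          ≡⟨ cong (R zero * v zero +_) (Σᶠ-+ (λ j → eliminated r j * v′ j) (λ j → factor r * (M r₀ (suc j) * v′ j))) ⟩
        R zero * v zero + (Σᶠ (λ j → eliminated r j * v′ j) + Σᶠ (λ j → factor r * (M r₀ (suc j) * v′ j)))
          ≡⟨ cong₂ (λ x y → R zero * v zero + (x + y)) (rows′ r) (Σᶠ-*ˡ (factor r) (λ j → M r₀ (suc j) * v′ j)) ⟩
        R zero * - (s * 1/ M r₀ zero) + (0ℚ + (R zero * 1/ M r₀ zero) * s)
          ≡⟨ solve 3 (λ x s d⁻¹ → x :* (:- (s :* d⁻¹)) :+ (con 0ℚ :+ (x :* d⁻¹) :* s) := con 0ℚ)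
                   refl (R zero) s (1/ M r₀ zero) ⟩
        0ℚ ∎
        where
        open ≡-Reasoning
        R : Fin (suc k) → ℚ
        R = M (punchIn r₀ r)
        split : ∀ x c y w → x * w ≡ (x - c * y) * w + c * (y * w)
        split = solve 4 (λ x c y w → x :* w := (x :- c :* y) :* w :+ c :* (y :* w)) refl
      rows : ∀ r → Σᶠ (λ j → M r j * v j) ≡ 0ℚ
      rows r with r₀ ≟ r
      ... | yes refl  = pivotRow
      ... | no r₀≢r   = subst (λ r → Σᶠ (λ j → M r j * v j) ≡ 0ℚ) (punchIn-punchOut r₀≢r)
                              (otherRow (punchOut r₀≢r))

  underdetermined-solvable : ∀ {e k} → e ℕ.< k → (M : Fin e → Fin k → ℚ) → NontrivialSolution M
  underdetermined-solvable {k = suc k} e<k M with any? (λ r → ¬? (M r zero ≟₀ 0ℚ))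
  ... | no ¬pivot = zeroColumn-solution M col≡0
    where
    col≡0 : ∀ r → M r zero ≡ 0ℚ
    col≡0 r with M r zero ≟₀ 0ℚ
    ... | yes M≡0 = M≡0
    ... | no M≢0  = ⊥-elim (¬pivot (r , M≢0))
  underdetermined-solvable {suc e} {suc k} e<k M | yes (r₀ , M₀≢0) =
    Pivot.backSubstitute M r₀ M₀≢0 (underdetermined-solvable (ℕ.≤-pred e<k) (Pivot.eliminated M r₀ M₀≢0))

  dependence⇒¬affinelyIndependent : ∀ {k m} (ps : Fin k → Fin m → ℚ) (v : Fin k → ℚ) → (∃ λ i → v i ≢ 0ℚ) →
                                    Σᶠ v ≡ 0ℚ → (∀ e → lincomb v ps e ≡ 0ℚ) → ¬ AffinelyIndependent ps
  dependence⇒¬affinelyIndependent ps v (i , vi≢0) Σv≡0 lc≡0 ai = vi≢0 (ai v Σv≡0 lc≡0 i)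

  ¬affinelyIndependent-[m+2] : ∀ {m} (ps : Fin (suc (suc m)) → Fin m → ℚ) → ¬ AffinelyIndependent ps
  ¬affinelyIndependent-[m+2] {m} ps with underdetermined-solvable (ℕ.n<1+n (suc m)) M
    where
    M : Fin (suc m) → Fin (suc (suc m)) → ℚ
    M zero    j = 1ℚ
    M (suc e) j = ps j e
  ... | v , v≢0 , rows = dependence⇒¬affinelyIndependent ps v v≢0
    (trans (Σᶠ-cong (λ j → sym (*-identityˡ (v j)))) (rows zero))
    (λ e → trans (Σᶠ-cong (λ j → *-comm (v j) (ps j e))) (rows (suc e)))

  ¬affinelyIndependent-[m+1]-onHyperplane : ∀ {m} (ps : Fin (suc m) → Fin m → ℚ) (a : Fin m → ℚ) (b : ℚ) →
                                            b ≢ 0ℚ → (∀ i → a · ps i ≡ b) → ¬ AffinelyIndependent ps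
  ¬affinelyIndependent-[m+1]-onHyperplane {m} ps a b b≢0 onH
    with underdetermined-solvable (ℕ.n<1+n m) (λ e j → ps j e)
  ... | v , v≢0 , rows = dependence⇒¬affinelyIndependent ps v v≢0 (*-cancelʳ-≡0 (Σᶠ v) b b≢0 Σv*b≡0) lc≡0
    where
    lc≡0 : ∀ e → lincomb v ps e ≡ 0ℚ
    lc≡0 e = trans (Σᶠ-cong (λ j → *-comm (v j) (ps j e))) (rows e)
    Σv*b≡0 : Σᶠ v * b ≡ 0ℚ
    Σv*b≡0 = begin
      Σᶠ v * b                       ≡⟨ *-comm (Σᶠ v) b ⟩
      b * Σᶠ v                       ≡⟨ sym (Σᶠ-*ˡ b v) ⟩
      Σᶠ (λ j → b * v j)             ≡⟨ Σᶠ-cong (λ j → trans (*-comm b (v j)) (cong (v j *_) (sym (onH j)))) ⟩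
      Σᶠ (λ j → v j * (a · ps j))    ≡⟨ sym (·-lincomb a v ps) ⟩
      a · lincomb v ps               ≡⟨ ·-zeroʳ a _ lc≡0 ⟩
      0ℚ                             ∎
      where open ≡-Reasoning

  triangular⇒affinelyIndependent :
    ∀ {k m} (ps φ : Fin k → Fin m → ℚ) (c : Fin k → ℚ) (ρ : Fin k → ℕ.ℕ) →
    (∀ i → φ i · ps i - c i ≢ 0ℚ) → (∀ i j → j ≢ i → ρ i ℕ.≤ ρ j → φ i · ps j ≡ c i) →
    AffinelyIndependent ps
  triangular⇒affinelyIndependent {k} ps φ c ρ diag upper λs Σλ≡0 lc≡0 i = <-rec Vanish vanish (ρ i) i refl
    where
    Vanish : ℕ.ℕ → Set
    Vanish r = ∀ i → ρ i ≡ r → λs i ≡ 0ℚ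
    weighted : ∀ i → Σᶠ (λ j → λs j * (φ i · ps j - c i)) ≡ 0ℚ
    weighted i = begin
      Σᶠ (λ j → λs j * (φ i · ps j - c i))
        ≡⟨ Σᶠ-cong (λ j → solve 3 (λ l x y → l :* (x :- y) := l :* x :+ (:- y) :* l) refl (λs j) (φ i · ps j) (c i)) ⟩
      Σᶠ (λ j → λs j * (φ i · ps j) + (- c i) * λs j)
        ≡⟨ Σᶠ-+ (λ j → λs j * (φ i · ps j)) (λ j → (- c i) * λs j) ⟩
      Σᶠ (λ j → λs j * (φ i · ps j)) + Σᶠ (λ j → (- c i) * λs j)
        ≡⟨ cong₂ _+_ (sym (·-lincomb (φ i) λs ps)) (Σᶠ-*ˡ (- c i) λs) ⟩
      φ i · lincomb λs ps + (- c i) * Σᶠ λs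
        ≡⟨ cong₂ _+_ (·-zeroʳ (φ i) _ lc≡0) (trans (cong ((- c i) *_) Σλ≡0) (*-zeroʳ (- c i))) ⟩
      0ℚ ∎
      where open ≡-Reasoning
    vanish : ∀ r → (∀ {r′} → r′ ℕ.< r → Vanish r′) → Vanish r
    vanish r below i refl = *-cancelʳ-≡0 (λs i) _ (diag i) (trans (sym (Σᶠ-single _ i others)) (weighted i))
      where
      others : ∀ j → j ≢ i → λs j * (φ i · ps j - c i) ≡ 0ℚ
      others j j≢i with ρ i ℕ.≤? ρ j
      ... | yes ρi≤ρj = begin
        λs j * (φ i · ps j - c i)  ≡⟨ cong (λ t → λs j * (t - c i)) (upper i j j≢i ρi≤ρj) ⟩
        λs j * (c i - c i)         ≡⟨ cong (λs j *_) (+-inverseʳ (c i)) ⟩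
        λs j * 0ℚ                  ≡⟨ *-zeroʳ (λs j) ⟩
        0ℚ                         ∎
        where open ≡-Reasoning
      ... | no ρi≰ρj = trans (cong (_* (φ i · ps j - c i)) (below (ℕ.≰⇒> ρi≰ρj) j refl)) (*-zeroˡ (φ i · ps j - c i))

  fullDimensional-facet :
    ∀ {m} (P : Region (suc m)) (a : Fin (suc m) → ℚ) (b : ℚ) → Valid P a b → b ≢ 0ℚ →
    (ps : Fin (suc (suc m)) → Fin (suc m) → ℚ) → (∀ i → P (ps i)) → AffinelyIndependent ps →
    (qs : Fin (suc m) → Fin (suc m) → ℚ) → (∀ i → Face P a b (qs i)) → AffinelyIndependent qs →
    FacetDefining P a b
  fullDimensional-facet {m} P a b valid b≢0 ps ps∈P ps-ai qs qs∈F qs-ai =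
    valid , m , ((ps , ps∈P , ps-ai) , λ ps′ _ → ¬affinelyIndependent-[m+2] ps′)
              , ((qs , qs∈F , qs-ai) , λ qs′ qs′∈F →
                   ¬affinelyIndependent-[m+1]-onHyperplane qs′ a b b≢0 (λ i → proj₂ (qs′∈F i)))

module SpecialTriples where

  open import Agda.Builtin.FromNat using (Number; fromNat)
  open import Data.Unit using (tt)
  import Data.Nat.Literals as ℕLiterals
  import Data.Fin.Literals as FinLiterals
  import Data.Rational.Literals as ℚLiterals
  open import Data.Fin using (Fin; _<_; _<?_; _≟_)
  open import Data.Fin.Properties using (all?)
  open import Data.Rational using (ℚ; 0ℚ; 1ℚ; _*_)
  open import Data.Rational.Properties using () renaming (_≟_ to _≟₀_)
  open import Data.Vec using (Vec; _∷_; []; lookup)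
  open import Data.List using (List; _∷_; [])
  open import Data.Bool using (if_then_else_)
  open import Relation.Nullary using (does)
  open import Relation.Nullary.Decidable using (from-yes; _→-dec_; ¬?)
  open import Relation.Binary.PropositionalEquality

  instance
    ⊤-instance = tt
    ℕ-number = ℕLiterals.number
    ℚ-number = ℚLiterals.number
    ℚ-negative = ℚLiterals.negative
    Fin-number : ∀ {n} → Number (Fin n)
    Fin-number {n} = FinLiterals.number n

  open import Data.List.Membership.DecPropositional (_≟_ {5}) using (_∈?_) public

  -- Five triples on five special cheap indices, numbered 0 … 4; row t of weights is the functional
  -- assigned to triple t, and entry is the matrix of their values, checked triangular by evaluation.
  members : Vec (List (Fin 5)) 5
  members = (0 ∷ 1 ∷ 3 ∷ [])
          ∷ (0 ∷ 2 ∷ 4 ∷ [])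
          ∷ (0 ∷ 2 ∷ 3 ∷ [])
          ∷ (1 ∷ 2 ∷ 4 ∷ [])
          ∷ (1 ∷ 3 ∷ 4 ∷ [])
          ∷ []

  weights : Vec (Vec ℚ 5) 5
  weights = (-2 ∷ -2 ∷ 1 ∷ 1 ∷ 1 ∷ [])
          ∷ ( 0 ∷ -1 ∷ 0 ∷ 0 ∷ 1 ∷ [])
          ∷ ( 1 ∷  0 ∷ 0 ∷ 0 ∷ 0 ∷ [])
          ∷ ( 0 ∷  0 ∷ 1 ∷ 0 ∷ 0 ∷ [])
          ∷ ( 0 ∷  1 ∷ 0 ∷ 0 ∷ 0 ∷ [])
          ∷ []

  𝟙ᶠ[_∈_] : Fin 5 → List (Fin 5) → ℚ
  𝟙ᶠ[ s ∈ ts ] = if does (s ∈? ts) then 1ℚ else 0ℚ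

  entry : Fin 5 → Fin 5 → ℚ
  entry t t′ = Σᶠ (λ s → lookup (lookup weights t) s * 𝟙ᶠ[ s ∈ lookup members t′ ])

  entry-upper : ∀ t t′ → t < t′ → entry t t′ ≡ 0ℚ
  entry-upper = from-yes (all? λ t → all? λ t′ → t <? t′ →-dec (entry t t′ ≟₀ 0ℚ))

  entry-diagonal : ∀ t → entry t t ≢ 0ℚ
  entry-diagonal = from-yes (all? λ t → ¬? (entry t t ≟₀ 0ℚ))

module Parity where

  open import Data.Nat
  open import Data.Nat.Properties using (*-comm)
  open import Data.Nat.DivMod using (m%n<n; [m+kn]%n≡m%n)
  open import Data.Sum using (_⊎_; inj₁; inj₂)
  open import Relation.Binary.PropositionalEquality

  split : ∀ {q} → q ≤ 1 → ∀ x → x % 2 ≡ q ⊎ x % 2 ≡ 1 ∸ q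
  split {q} q≤1 x = go (x % 2) q (m%n<n x 2) q≤1
    where
    go : ∀ r q → r < 2 → q ≤ 1 → r ≡ q ⊎ r ≡ 1 ∸ q
    go 0 0 _ _ = inj₁ refl
    go 0 1 _ _ = inj₂ refl
    go 1 0 _ _ = inj₂ refl
    go 1 1 _ _ = inj₁ refl
    go (suc (suc _)) _ (s≤s (s≤s ())) _
    go _ (suc (suc _)) _ (s≤s ())

  [r+2x]%2≡r%2 : ∀ r x → (r + 2 * x) % 2 ≡ r % 2
  [r+2x]%2≡r%2 r x = trans (cong (λ k → (r + k) % 2) (*-comm 2 x)) ([m+kn]%n≡m%n r x 2)

  q≢1∸q : ∀ {q} → q ≤ 1 → q ≢ 1 ∸ q
  q≢1∸q z≤n       ()
  q≢1∸q (s≤s z≤n) ()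

module Cycle (h : ℕ.ℕ) (hn : 5 ℕ.≤ ℕ.suc (2 ℕ.* h)) where

  open import Data.Nat
  open import Data.Nat.Properties
  open import Data.Nat.DivMod
  open import Data.Fin as Fin using (Fin; toℕ)
  open import Data.Fin.Properties as Fin using (toℕ-injective; toℕ-fromℕ<)
  open import Data.Product using (∃; _×_; _,_; proj₁; proj₂)
  open import Data.Sum using (_⊎_; inj₁; inj₂; [_,_]; swap)
  open import Data.List using (List; []; _∷_; length)
  open import Data.List.Membership.Propositional using (_∉_)
  open import Data.List.Membership.DecPropositional _≟_ using (_∈?_)
  open import Data.List.Relation.Unary.Any using (here; there)
  open import Data.List.Relation.Unary.All as All using (All; []; _∷_)
  open import Data.Bool using (true; false; if_then_else_)
  open import Data.Bool.Properties using (¬-not)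
  open import Relation.Nullary using (¬_; yes; no; does; contradiction)
  open import Relation.Nullary.Decidable using (dec-true; dec-false)
  open import Relation.Binary.Definitions using (tri<; tri≈; tri>)
  open import Relation.Binary.PropositionalEquality hiding ([_])
  open import Function using (_∘_)
  open import Data.Nat.Divisibility using (m∣m*n)
  open import Data.Nat.Solver using (module +-*-Solver)
  open +-*-Solver using (solve; _:+_; _:*_; _:=_; con)

  n : ℕ
  n = suc (2 * h)

  m : ℕ
  m = 2 * n

  G : Graph
  G = C n hn

  S : PairSet G
  S = Sᶜ n hn

  ⟦_⟧ : ℕ → Fin m
  ⟦ k ⟧ = md n hn k

  n+n≡m : n + n ≡ m
  n+n≡m = cong (n +_) (sym (+-identityʳ n))

  n<m : n < m
  n<m = subst (n <_) n+n≡m (m<m+n n z<s)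

  toℕ-⟦⟧ : ∀ k → toℕ ⟦ k ⟧ ≡ k % m
  toℕ-⟦⟧ k = toℕ-fromℕ< (m%n<n k m)

  toℕ-⟦⟧-< : ∀ {k} → k < m → toℕ ⟦ k ⟧ ≡ k
  toℕ-⟦⟧-< {k} k<m = trans (toℕ-⟦⟧ k) (m<n⇒m%n≡m k<m)

  ⟦⟧-cong-% : ∀ a b → a % m ≡ b % m → ⟦ a ⟧ ≡ ⟦ b ⟧
  ⟦⟧-cong-% a b a≡b = toℕ-injective (trans (toℕ-⟦⟧ a) (trans a≡b (sym (toℕ-⟦⟧ b))))

  ⟦⟧-injective-< : ∀ {a b} → a < m → b < m → ⟦ a ⟧ ≡ ⟦ b ⟧ → a ≡ b
  ⟦⟧-injective-< a<m b<m eq = trans (sym (toℕ-⟦⟧-< a<m)) (trans (cong toℕ eq) (toℕ-⟦⟧-< b<m))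

  ⟦toℕ⟧ : ∀ (e : Fin m) → ⟦ toℕ e ⟧ ≡ e
  ⟦toℕ⟧ e = toℕ-injective (toℕ-⟦⟧-< (Fin.toℕ<n e))

  ⟦%⟧ : ∀ a → ⟦ a % m ⟧ ≡ ⟦ a ⟧
  ⟦%⟧ a = ⟦⟧-cong-% (a % m) a (m%n%n≡m%n a m)

  ⟦+m⟧ : ∀ a → ⟦ a + m ⟧ ≡ ⟦ a ⟧
  ⟦+m⟧ a = ⟦⟧-cong-% (a + m) a ([m+n]%n≡m%n a m)

  ⟦⟧-+ʳ : ∀ a b c → ⟦ a ⟧ ≡ ⟦ b ⟧ → ⟦ a + c ⟧ ≡ ⟦ b + c ⟧
  ⟦⟧-+ʳ a b c eq = ⟦⟧-cong-% (a + c) (b + c) (begin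
    (a + c) % m              ≡⟨ %-distribˡ-+ a c m ⟩
    (a % m + c % m) % m      ≡⟨ cong (λ r → (r + c % m) % m) a%≡b% ⟩
    (b % m + c % m) % m      ≡⟨ %-distribˡ-+ b c m ⟨
    (b + c) % m              ∎)
    where
    open ≡-Reasoning
    a%≡b% : a % m ≡ b % m
    a%≡b% = trans (sym (toℕ-⟦⟧ a)) (trans (cong toℕ eq) (toℕ-⟦⟧ b))

  ⟦⟧-+ˡ : ∀ c a b → ⟦ a ⟧ ≡ ⟦ b ⟧ → ⟦ c + a ⟧ ≡ ⟦ c + b ⟧
  ⟦⟧-+ˡ c a b eq = subst₂ (λ x y → ⟦ x ⟧ ≡ ⟦ y ⟧) (+-comm a c) (+-comm b c) (⟦⟧-+ʳ a b c eq)

  ⟦suc⟧ : ∀ k → ⟦ suc (toℕ ⟦ k ⟧) ⟧ ≡ ⟦ suc k ⟧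
  ⟦suc⟧ k = trans (cong (λ r → ⟦ suc r ⟧) (toℕ-⟦⟧ k)) (⟦⟧-+ˡ 1 (k % m) k (⟦%⟧ k))

  Reach-trans : ∀ {δ u v w} → Reach G δ u v → Reach G δ v w → Reach G δ u w
  Reach-trans r here                 = r
  Reach-trans r (step r′ e uncut at) = step (Reach-trans r r′) e uncut at

  Reach-sym : ∀ {δ u w} → Reach G δ u w → Reach G δ w u
  Reach-sym here                  = here
  Reach-sym (step r e uncut at) = Reach-trans (step here e uncut (swap at)) (Reach-sym r)

  arc⇒Reach : ∀ {δ : EdgeSet G} a L → (∀ t → t < L → δ ⟦ a + t ⟧ ≡ false) → Reach G δ ⟦ a ⟧ ⟦ a + L ⟧
  arc⇒Reach {δ} a zero    uncut = subst (λ k → Reach G δ ⟦ a ⟧ ⟦ k ⟧) (sym (+-identityʳ a)) here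
  arc⇒Reach {δ} a (suc L) uncut =
    step (arc⇒Reach a L (λ t t<L → uncut t (m<n⇒m<1+n t<L))) ⟦ a + L ⟧ (uncut L (n<1+n L))
         (inj₁ (cong (⟦ a + L ⟧ ,_) (trans (⟦suc⟧ (a + L)) (cong ⟦_⟧ (sym (+-suc a L))))))

  RespectedBy : EdgeSet G → (ℕ → ℕ) → Set
  RespectedBy δ label = ∀ e → δ e ≡ false → label (toℕ e) ≡ label (suc (toℕ e) % m)

  Reach⇒label-≡ : ∀ {δ} label → RespectedBy δ label → ∀ {u w} → Reach G δ u w → label (toℕ u) ≡ label (toℕ w)
  Reach⇒label-≡ label resp here = refl
  Reach⇒label-≡ label resp (step {w} {w′} r e uncut (inj₁ at)) = begin
    _                             ≡⟨ Reach⇒label-≡ label resp r ⟩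
    label (toℕ w)                 ≡⟨ cong (label ∘ toℕ) (cong proj₁ at) ⟨
    label (toℕ e)                 ≡⟨ resp e uncut ⟩
    label (suc (toℕ e) % m)       ≡⟨ cong label (toℕ-⟦⟧ (suc (toℕ e))) ⟨
    label (toℕ ⟦ suc (toℕ e) ⟧)   ≡⟨ cong (label ∘ toℕ) (cong proj₂ at) ⟩
    label (toℕ w′)                ∎
    where open ≡-Reasoning
  Reach⇒label-≡ label resp (step {w} {w′} r e uncut (inj₂ at)) = begin
    _                             ≡⟨ Reach⇒label-≡ label resp r ⟩
    label (toℕ w)                 ≡⟨ cong (label ∘ toℕ) (cong proj₂ at) ⟨
    label (toℕ ⟦ suc (toℕ e) ⟧)   ≡⟨ cong label (toℕ-⟦⟧ (suc (toℕ e))) ⟩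
    label (suc (toℕ e) % m)       ≡⟨ resp e uncut ⟨
    label (toℕ e)                 ≡⟨ cong (label ∘ toℕ) (cong proj₁ at) ⟩
    label (toℕ w′)                ∎
    where open ≡-Reasoning

  SeparatesAntipodes : (ℕ → ℕ) → Set
  SeparatesAntipodes label = ∀ i → i < n → label i ≢ label (i + n)

  labelling⇒multicut : ∀ δ label → RespectedBy δ label → SeparatesAntipodes label → IsMulticut G S δ
  labelling⇒multicut δ label resp sep s t (i , 1≤i , i≤n , refl , refl) r with i <? n
  ... | yes i<n = sep i i<n (subst₂ (λ x y → label x ≡ label y) (toℕ-⟦⟧-< (<-trans i<n n<m))
                                     (toℕ-⟦⟧-< (subst (i + n <_) n+n≡m (+-monoˡ-< n i<n)))
                                     (Reach⇒label-≡ label resp r))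
  ... | no i≮n with ≤-antisym i≤n (≮⇒≥ i≮n)
  ...   | refl = sep 0 z<s (subst₂ (λ x y → label x ≡ label y) toℕ-⟦n+n⟧ (toℕ-⟦⟧-< n<m)
                                   (sym (Reach⇒label-≡ label resp r)))
    where
    toℕ-⟦n+n⟧ : toℕ ⟦ n + n ⟧ ≡ 0
    toℕ-⟦n+n⟧ = trans (toℕ-⟦⟧ (n + n)) (trans (cong (_% m) n+n≡m) (n%n≡0 m))

  SamePair : ℕ → ℕ → Set
  SamePair a i = ⟦ a ⟧ ≡ ⟦ i ⟧ × ⟦ a + n ⟧ ≡ ⟦ i + n ⟧ ⊎ ⟦ a ⟧ ≡ ⟦ i + n ⟧ × ⟦ a + n ⟧ ≡ ⟦ i ⟧

  antipodes-∈S : ∀ a → ∃ λ i → 1 ≤ i × i ≤ n × SamePair a i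
  antipodes-∈S a = classify (a % m) refl
    where
    ⟦a⟧≡ : ∀ {r} → a % m ≡ r → ⟦ a ⟧ ≡ ⟦ r ⟧
    ⟦a⟧≡ a%m = trans (sym (⟦%⟧ a)) (cong ⟦_⟧ a%m)
    classify : ∀ r → a % m ≡ r → ∃ λ i → 1 ≤ i × i ≤ n × SamePair a i
    classify zero a%m = n , s≤s z≤n , ≤-refl , inj₂ (⟦a⟧≡⟦n+n⟧ , ⟦⟧-+ʳ a 0 n (⟦a⟧≡ a%m))
      where
      ⟦a⟧≡⟦n+n⟧ : ⟦ a ⟧ ≡ ⟦ n + n ⟧
      ⟦a⟧≡⟦n+n⟧ = trans (⟦a⟧≡ a%m) (trans (sym (⟦+m⟧ 0)) (cong ⟦_⟧ (sym n+n≡m)))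
    classify (suc r) a%m with suc r ≤? n
    ... | yes 1+r≤n = suc r , s≤s z≤n , 1+r≤n , inj₁ (⟦a⟧≡ a%m , ⟦⟧-+ʳ a (suc r) n (⟦a⟧≡ a%m))
    ... | no 1+r≰n  = i , m<n⇒0<n∸m n<r , i≤n , inj₂ (⟦a⟧≡⟦i+n⟧ , ⟦a+n⟧≡⟦i⟧)
      where
      n<r : n < suc r
      n<r = ≰⇒> 1+r≰n
      i : ℕ
      i = suc r ∸ n
      i+n≡r : i + n ≡ suc r
      i+n≡r = m∸n+n≡m (<⇒≤ n<r)
      i≤n : i ≤ n
      i≤n = <⇒≤ (+-cancelʳ-< n i n (subst₂ _<_ (sym i+n≡r) (sym n+n≡m) (subst (_< m) a%m (m%n<n a m))))
      ⟦a⟧≡⟦i+n⟧ : ⟦ a ⟧ ≡ ⟦ i + n ⟧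
      ⟦a⟧≡⟦i+n⟧ = trans (⟦a⟧≡ a%m) (cong ⟦_⟧ (sym i+n≡r))
      ⟦a+n⟧≡⟦i⟧ : ⟦ a + n ⟧ ≡ ⟦ i ⟧
      ⟦a+n⟧≡⟦i⟧ = begin
        ⟦ a + n ⟧        ≡⟨ ⟦⟧-+ʳ a (i + n) n ⟦a⟧≡⟦i+n⟧ ⟩
        ⟦ i + n + n ⟧    ≡⟨ cong ⟦_⟧ (trans (+-assoc i n n) (cong (i +_) n+n≡m)) ⟩
        ⟦ i + m ⟧        ≡⟨ ⟦+m⟧ i ⟩
        ⟦ i ⟧            ∎
        where open ≡-Reasoning

  multicut⇒¬Reach-antipodes : ∀ {δ} → IsMulticut G S δ → ∀ a → ¬ Reach G δ ⟦ a ⟧ ⟦ a + n ⟧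
  multicut⇒¬Reach-antipodes {δ} mc a r with antipodes-∈S a
  ... | i , 1≤i , i≤n , inj₁ (a≡i , a+n≡i+n) =
    mc ⟦ i ⟧ ⟦ i + n ⟧ (i , 1≤i , i≤n , refl , refl) (subst₂ (Reach G δ) a≡i a+n≡i+n r)
  ... | i , 1≤i , i≤n , inj₂ (a≡i+n , a+n≡i) =
    mc ⟦ i ⟧ ⟦ i + n ⟧ (i , 1≤i , i≤n , refl , refl) (subst₂ (Reach G δ) a+n≡i a≡i+n (Reach-sym r))

  multicut-cuts-every-arc : ∀ {δ} → IsMulticut G S δ → ∀ a → ¬ (∀ t → t < n → δ ⟦ a + t ⟧ ≡ false)
  multicut-cuts-every-arc mc a uncut = multicut⇒¬Reach-antipodes mc a (arc⇒Reach a n uncut)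

  ⟦+⟧≢ : ∀ x d → 0 < d → d < m → ⟦ x + d ⟧ ≢ ⟦ x ⟧
  ⟦+⟧≢ x d 0<d d<m eq with x % m + d <? m
  ... | yes r+d<m = <⇒≢ (m<m+n r 0<d) (⟦⟧-injective-< r<m r+d<m ⟦r⟧≡⟦r+d⟧)
    where
    r = x % m
    r<m = m%n<n x m
    ⟦r⟧≡⟦r+d⟧ : ⟦ r ⟧ ≡ ⟦ r + d ⟧
    ⟦r⟧≡⟦r+d⟧ = trans (⟦%⟧ x) (trans (sym eq) (sym (⟦⟧-+ʳ r x d (⟦%⟧ x))))
  ... | no r+d≮m = <⇒≢ d<m (+-cancelˡ-≡ r d m (trans (sym s+m≡r+d) (cong (_+ m) s≡r)))
    where
    r = x % m
    r<m = m%n<n x m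
    s = r + d ∸ m
    s+m≡r+d : s + m ≡ r + d
    s+m≡r+d = m∸n+n≡m (≮⇒≥ r+d≮m)
    s<m : s < m
    s<m = +-cancelʳ-< m s m (subst (_< m + m) (sym s+m≡r+d) (+-mono-< r<m d<m))
    s≡r : s ≡ r
    s≡r = ⟦⟧-injective-< s<m r<m (begin
      ⟦ s ⟧           ≡⟨ ⟦+m⟧ s ⟨
      ⟦ s + m ⟧       ≡⟨ cong ⟦_⟧ s+m≡r+d ⟩
      ⟦ r + d ⟧       ≡⟨ ⟦⟧-+ʳ r x d (⟦%⟧ x) ⟩
      ⟦ x + d ⟧       ≡⟨ eq ⟩
      ⟦ x ⟧           ≡⟨ ⟦%⟧ x ⟨
      ⟦ r ⟧           ∎)
      where open ≡-Reasoning

  ⟦⟧-window-≢ : ∀ {x y} → x < y → y < x + m → ⟦ y ⟧ ≢ ⟦ x ⟧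
  ⟦⟧-window-≢ {x} {y} x<y y<x+m = subst (λ z → ⟦ z ⟧ ≢ ⟦ x ⟧) x+d≡y
    (⟦+⟧≢ x (y ∸ x) (m<n⇒0<n∸m x<y) (+-cancelˡ-< x (y ∸ x) m (subst (_< x + m) (sym x+d≡y) y<x+m)))
    where
    x+d≡y : x + (y ∸ x) ≡ y
    x+d≡y = m+[n∸m]≡n (<⇒≤ x<y)

  avoids-pair⇒uncut : ∀ {δ : EdgeSet G} {j k} → (∀ e → δ e ≡ true → e ≡ j ⊎ e ≡ k) →
                      ∀ a → (∀ t → t < n → ⟦ a + t ⟧ ≢ ⟦ toℕ j ⟧) → (∀ t → t < n → ⟦ a + t ⟧ ≢ ⟦ toℕ k ⟧) →
                      ∀ t → t < n → δ ⟦ a + t ⟧ ≡ false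
  avoids-pair⇒uncut {j = j} {k} cuts⊆jk a ≢j ≢k t t<n = ¬-not λ cut →
    [ (λ e≡j → ≢j t t<n (trans e≡j (sym (⟦toℕ⟧ j)))) , (λ e≡k → ≢k t t<n (trans e≡k (sym (⟦toℕ⟧ k)))) ]
    (cuts⊆jk _ cut)

  cuts⊆nonAntipodalPair⇒¬multicut :
    ∀ {δ} → IsMulticut G S δ → ∀ j k → toℕ j ≤ toℕ k → toℕ k ≢ toℕ j + n →
    ¬ (∀ e → δ e ≡ true → e ≡ j ⊎ e ≡ k)
  cuts⊆nonAntipodalPair⇒¬multicut {δ} mc j k j≤k k≢j+n cuts⊆jk with <-cmp (toℕ k) (toℕ j + n)
  ... | tri≈ _ k≡j+n _ = k≢j+n k≡j+n
  ... | tri< k<j+n _ _ = multicut-cuts-every-arc mc (toℕ k + 1) (avoids-pair⇒uncut cuts⊆jk (toℕ k + 1) avoid-j avoid-k)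
    where
    y≤k+n : ∀ {t} → t < n → toℕ k + 1 + t ≤ toℕ k + n
    y≤k+n t<n = subst (_≤ toℕ k + n) (sym (+-assoc (toℕ k) 1 _)) (+-monoʳ-≤ (toℕ k) t<n)
    avoid-k : ∀ t → t < n → ⟦ toℕ k + 1 + t ⟧ ≢ ⟦ toℕ k ⟧
    avoid-k t t<n = ⟦⟧-window-≢ (subst (toℕ k <_) (sym (+-assoc (toℕ k) 1 t)) (m<m+n (toℕ k) z<s))
                                (≤-<-trans (y≤k+n t<n) (+-monoʳ-< (toℕ k) n<m))
    avoid-j : ∀ t → t < n → ⟦ toℕ k + 1 + t ⟧ ≢ ⟦ toℕ j ⟧
    avoid-j t t<n = ⟦⟧-window-≢ (≤-<-trans j≤k (subst (toℕ k <_) (sym (+-assoc (toℕ k) 1 t)) (m<m+n (toℕ k) z<s)))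
                                (≤-<-trans (y≤k+n t<n) (subst (toℕ k + n <_) j+n+n≡j+m (+-monoˡ-< n k<j+n)))
      where
      j+n+n≡j+m : toℕ j + n + n ≡ toℕ j + m
      j+n+n≡j+m = trans (+-assoc (toℕ j) n n) (cong (toℕ j +_) n+n≡m)
  ... | tri> _ _ j+n<k = multicut-cuts-every-arc mc (toℕ j + 1) (avoids-pair⇒uncut cuts⊆jk (toℕ j + 1) avoid-j avoid-k)
    where
    y<k : ∀ {t} → t < n → toℕ j + 1 + t < toℕ k
    y<k t<n = ≤-<-trans (subst (_≤ toℕ j + n) (sym (+-assoc (toℕ j) 1 _)) (+-monoʳ-≤ (toℕ j) t<n)) j+n<k
    avoid-j : ∀ t → t < n → ⟦ toℕ j + 1 + t ⟧ ≢ ⟦ toℕ j ⟧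
    avoid-j t t<n = ⟦⟧-window-≢ (subst (toℕ j <_) (sym (+-assoc (toℕ j) 1 t)) (m<m+n (toℕ j) z<s))
                                (<-trans (y<k t<n) (<-≤-trans (Fin.toℕ<n k) (m≤n+m m (toℕ j))))
    avoid-k : ∀ t → t < n → ⟦ toℕ j + 1 + t ⟧ ≢ ⟦ toℕ k ⟧
    avoid-k t t<n eq = ⟦⟧-window-≢ (y<k t<n) (<-≤-trans (Fin.toℕ<n k) (m≤n+m m _)) (sym eq)

  cutsBelow : List ℕ → ℕ → ℕ
  cutsBelow []       x = 0
  cutsBelow (c ∷ cs) x = if does (c <? x) then suc (cutsBelow cs x) else cutsBelow cs x

  cutsBelow-< : ∀ {c x} cs → c < x → cutsBelow (c ∷ cs) x ≡ suc (cutsBelow cs x)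
  cutsBelow-< {c} {x} cs c<x rewrite dec-true (c <? x) c<x = refl

  cutsBelow-≥ : ∀ {c x} cs → x ≤ c → cutsBelow (c ∷ cs) x ≡ cutsBelow cs x
  cutsBelow-≥ {c} {x} cs x≤c rewrite dec-false (c <? x) (≤⇒≯ x≤c) = refl

  cutsBelow-zero : ∀ cs → cutsBelow cs 0 ≡ 0
  cutsBelow-zero []       = refl
  cutsBelow-zero (c ∷ cs) = trans (cutsBelow-≥ {c} cs z≤n) (cutsBelow-zero cs)

  cutsBelow-suc : ∀ cs {y} → y ∉ cs → cutsBelow cs (suc y) ≡ cutsBelow cs y
  cutsBelow-suc []       y∉cs = refl
  cutsBelow-suc (c ∷ cs) {y} y∉cs with <-cmp c y
  ... | tri< c<y _ _ = trans (cutsBelow-< cs (m<n⇒m<1+n c<y))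
                             (trans (cong suc (cutsBelow-suc cs (y∉cs ∘ there))) (sym (cutsBelow-< cs c<y)))
  ... | tri≈ _ c≡y _ = contradiction (here (sym c≡y)) y∉cs
  ... | tri> _ _ y<c = trans (cutsBelow-≥ cs y<c)
                             (trans (cutsBelow-suc cs (y∉cs ∘ there)) (sym (cutsBelow-≥ cs (<⇒≤ y<c))))

  cutsBelow-all : ∀ cs {y} → All (_< suc y) cs → y ∉ cs → cutsBelow cs y ≡ length cs
  cutsBelow-all []       []               y∉cs = refl
  cutsBelow-all (c ∷ cs) (c<1+y ∷ cs<1+y) y∉cs =
    trans (cutsBelow-< cs (≤∧≢⇒< (≤-pred c<1+y) (λ c≡y → y∉cs (here (sym c≡y)))))
          (cong suc (cutsBelow-all cs cs<1+y (y∉cs ∘ there)))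

  -- Counting the cut positions below a vertex, modulo their number, labels the arcs between cuts:
  -- past the last cut the count equals the number of cuts, i.e. 0, as on the first arc.
  arcLabel : ℕ → List ℕ → ℕ → ℕ
  arcLabel c cs x = cutsBelow (c ∷ cs) x % length (c ∷ cs)

  arcLabel-respected : ∀ δ c cs → All (_< m) (c ∷ cs) → (∀ e → δ e ≡ false → toℕ e ∉ c ∷ cs) →
                       RespectedBy δ (arcLabel c cs)
  arcLabel-respected δ c cs cs<m avoid e uncut with suc (toℕ e) <? m
  ... | yes 1+e<m = cong (_% length (c ∷ cs)) (trans (sym (cutsBelow-suc (c ∷ cs) (avoid e uncut)))
                                                     (cong (cutsBelow (c ∷ cs)) (sym (m<n⇒m%n≡m 1+e<m))))
  ... | no 1+e≮m = begin
    cutsBelow (c ∷ cs) (toℕ e) % length (c ∷ cs)         ≡⟨ cong (_% length (c ∷ cs)) (cutsBelow-all (c ∷ cs) cs<1+e (avoid e uncut)) ⟩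
    length (c ∷ cs) % length (c ∷ cs)                    ≡⟨ n%n≡0 (length (c ∷ cs)) ⟩
    0                                                    ≡⟨ cong (_% length (c ∷ cs)) (cutsBelow-zero (c ∷ cs)) ⟨
    cutsBelow (c ∷ cs) 0 % length (c ∷ cs)               ≡⟨ cong (arcLabel c cs) (n%n≡0 m) ⟨
    arcLabel c cs (m % m)                                ≡⟨ cong (λ k → arcLabel c cs (k % m)) 1+e≡m ⟨
    arcLabel c cs (suc (toℕ e) % m)                      ∎
    where
    open ≡-Reasoning
    1+e≡m : suc (toℕ e) ≡ m
    1+e≡m = ≤-antisym (Fin.toℕ<n e) (≮⇒≥ 1+e≮m)
    cs<1+e : All (_< suc (toℕ e)) (c ∷ cs)
    cs<1+e = All.map (λ {x} x<m → subst (x <_) (sym 1+e≡m) x<m) cs<m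

  arcLabel-≢ : ∀ c cs x y {a b} → cutsBelow (c ∷ cs) x ≡ a → cutsBelow (c ∷ cs) y ≡ b →
               a % length (c ∷ cs) ≢ b % length (c ∷ cs) → arcLabel c cs x ≢ arcLabel c cs y
  arcLabel-≢ c cs x y refl refl a≢b = a≢b

  antipodalPair-multicut : ∀ δ w → w < n → (∀ e → δ e ≡ false → toℕ e ∉ w ∷ w + n ∷ []) → IsMulticut G S δ
  antipodalPair-multicut δ w w<n avoid =
    labelling⇒multicut δ (arcLabel w cs′) (arcLabel-respected δ w cs′ bounds avoid) separated
    where
    cs′ = w + n ∷ []
    bounds : All (_< m) (w ∷ cs′)
    bounds = <-trans w<n n<m ∷ subst (w + n <_) n+n≡m (+-monoˡ-< n w<n) ∷ []
    separated : SeparatesAntipodes (arcLabel w cs′)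
    separated i i<n with i ≤? w
    ... | yes i≤w = arcLabel-≢ w cs′ i (i + n) below-i below-i+n (λ ())
      where
      below-i : cutsBelow (w ∷ cs′) i ≡ 0
      below-i = trans (cutsBelow-≥ cs′ i≤w) (cutsBelow-≥ [] (≤-trans i≤w (m≤m+n w n)))
      below-i+n : cutsBelow (w ∷ cs′) (i + n) ≡ 1
      below-i+n = trans (cutsBelow-< cs′ (<-≤-trans w<n (m≤n+m n i))) (cong suc (cutsBelow-≥ [] (+-monoˡ-≤ n i≤w)))
    ... | no i≰w  = arcLabel-≢ w cs′ i (i + n) below-i below-i+n (λ ())
      where
      below-i : cutsBelow (w ∷ cs′) i ≡ 1
      below-i = trans (cutsBelow-< cs′ (≰⇒> i≰w)) (cong suc (cutsBelow-≥ [] (≤-trans (<⇒≤ i<n) (m≤n+m n w))))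
      below-i+n : cutsBelow (w ∷ cs′) (i + n) ≡ 2
      below-i+n = trans (cutsBelow-< cs′ (<-≤-trans (≰⇒> i≰w) (m≤m+n i n)))
                        (cong suc (cutsBelow-< [] (+-monoˡ-< n (≰⇒> i≰w))))

  module ThreeCuts {u v w} (u<v : u < v) (v<w : v < w) (w<m : w < m)
                   (v≤u+n : v ≤ u + n) (w≤v+n : w ≤ v + n) (m+u≤w+n : m + u ≤ w + n) where

    cs′ : List ℕ
    cs′ = v ∷ w ∷ []

    n+n+u≤w+n : n + n + u ≤ w + n
    n+n+u≤w+n = subst (λ k → k + u ≤ w + n) (sym n+n≡m) m+u≤w+n

    u<n : u < n
    u<n = +-cancelˡ-< m u n (≤-<-trans m+u≤w+n (+-monoˡ-< n w<m))

    i≤w : ∀ {i} → i < n → i ≤ w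
    i≤w i<n = ≤-trans (<⇒≤ i<n) (+-cancelʳ-≤ n n w (≤-trans (m≤m+n (n + n) u) n+n+u≤w+n))

    v<i+n : ∀ {i} → i ≰ u → v < i + n
    v<i+n i≰u = ≤-<-trans v≤u+n (+-monoˡ-< n (≰⇒> i≰u))

    i≤u⇒i+n≤w : ∀ {i} → i ≤ u → i + n ≤ w
    i≤u⇒i+n≤w {i} i≤u = +-cancelʳ-≤ n (i + n) w (begin
      i + n + n    ≡⟨ +-assoc i n n ⟩
      i + (n + n)  ≡⟨ +-comm i (n + n) ⟩
      n + n + i    ≤⟨ +-monoʳ-≤ (n + n) i≤u ⟩
      n + n + u    ≤⟨ n+n+u≤w+n ⟩
      w + n        ∎)
      where open ≤-Reasoning

    below-i+n : ∀ i → cutsBelow (u ∷ cs′) (i + n) ≡ suc (cutsBelow cs′ (i + n))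
    below-i+n i = cutsBelow-< cs′ (<-≤-trans u<n (m≤n+m n i))

    below-i≤u : ∀ {i} → i < n → i ≤ u → cutsBelow (u ∷ cs′) i ≡ 0
    below-i≤u i<n i≤u =
      trans (cutsBelow-≥ cs′ i≤u) (trans (cutsBelow-≥ (w ∷ []) (≤-trans i≤u (<⇒≤ u<v))) (cutsBelow-≥ [] (i≤w i<n)))

    below-u<i≤v : ∀ {i} → i < n → i ≰ u → i ≤ v → cutsBelow (u ∷ cs′) i ≡ 1
    below-u<i≤v i<n i≰u i≤v =
      trans (cutsBelow-< cs′ (≰⇒> i≰u)) (cong suc (trans (cutsBelow-≥ (w ∷ []) i≤v) (cutsBelow-≥ [] (i≤w i<n))))

    separated : SeparatesAntipodes (arcLabel u cs′)
    separated i i<n with i ≤? u | i ≤? v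
    ... | yes i≤u | _ with v <? i + n
    ...   | yes v<i+n = arcLabel-≢ u cs′ i (i + n) (below-i≤u i<n i≤u)
                          (trans (below-i+n i) (cong suc (trans (cutsBelow-< (w ∷ []) v<i+n)
                                 (cong suc (cutsBelow-≥ [] (i≤u⇒i+n≤w i≤u))))))
                          (λ ())
    ...   | no v≮i+n  = arcLabel-≢ u cs′ i (i + n) (below-i≤u i<n i≤u)
                          (trans (below-i+n i) (cong suc (trans (cutsBelow-≥ (w ∷ []) (≮⇒≥ v≮i+n))
                                 (cutsBelow-≥ [] (i≤u⇒i+n≤w i≤u)))))
                          (λ ())
    separated i i<n | no i≰u | yes i≤v with w <? i + n
    ...   | yes w<i+n = arcLabel-≢ u cs′ i (i + n) (below-u<i≤v i<n i≰u i≤v)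
                          (trans (below-i+n i) (cong suc (trans (cutsBelow-< (w ∷ []) (v<i+n i≰u))
                                 (cong suc (cutsBelow-< [] w<i+n)))))
                          (λ ())
    ...   | no w≮i+n  = arcLabel-≢ u cs′ i (i + n) (below-u<i≤v i<n i≰u i≤v)
                          (trans (below-i+n i) (cong suc (trans (cutsBelow-< (w ∷ []) (v<i+n i≰u))
                                 (cong suc (cutsBelow-≥ [] (≮⇒≥ w≮i+n))))))
                          (λ ())
    separated i i<n | no i≰u | no i≰v = arcLabel-≢ u cs′ i (i + n)
      (trans (cutsBelow-< cs′ (≰⇒> i≰u)) (cong suc (trans (cutsBelow-< (w ∷ []) (≰⇒> i≰v)) (cong suc (cutsBelow-≥ [] (i≤w i<n))))))
      (trans (below-i+n i) (cong suc (trans (cutsBelow-< (w ∷ []) (v<i+n i≰u))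
             (cong suc (cutsBelow-< [] (≤-<-trans w≤v+n (+-monoˡ-< n (≰⇒> i≰v))))))))
      (λ ())

    multicut : ∀ δ → (∀ e → δ e ≡ false → toℕ e ∉ u ∷ cs′) → IsMulticut G S δ
    multicut δ avoid = labelling⇒multicut δ (arcLabel u cs′) (arcLabel-respected δ u cs′ bounds avoid) separated
      where
      bounds : All (_< m) (u ∷ cs′)
      bounds = <-trans u<v (<-trans v<w w<m) ∷ <-trans v<w w<m ∷ w<m ∷ []

  %m%2 : ∀ k → k % m % 2 ≡ k % 2
  %m%2 k = m∣n⇒o%n%m≡o%m 2 m k (m∣m*n n)

  toℕ-⟦⟧-%2 : ∀ k → toℕ ⟦ k ⟧ % 2 ≡ k % 2
  toℕ-⟦⟧-%2 k = trans (cong (_% 2) (toℕ-⟦⟧ k)) (%m%2 k)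

  +n-flips-parity : ∀ u → (u + n) % 2 ≢ u % 2
  +n-flips-parity u eq = flip (u % 2) (m%n<n u 2) (begin
    (u % 2 + 1) % 2              ≡⟨ [m+kn]%n≡m%n (u % 2 + 1) (u / 2 + h) 2 ⟨
    (u % 2 + 1 + (u / 2 + h) * 2) % 2  ≡⟨ cong (_% 2) (regroup (u % 2) (u / 2)) ⟩
    (u % 2 + u / 2 * 2 + n) % 2  ≡⟨ cong (λ k → (k + n) % 2) (m≡m%n+[m/n]*n u 2) ⟨
    (u + n) % 2                  ≡⟨ eq ⟩
    u % 2                        ∎)
    where
    open ≡-Reasoning
    regroup : ∀ r k → r + 1 + (k + h) * 2 ≡ r + k * 2 + n
    regroup r k = solve 3 (λ r k h → r :+ con 1 :+ (k :+ h) :* con 2 := r :+ k :* con 2 :+ (con 1 :+ con 2 :* h)) refl r k h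
    flip : ∀ r → r < 2 → (r + 1) % 2 ≢ r
    flip 0 _ ()
    flip 1 _ ()
    flip (suc (suc r)) (s≤s (s≤s ())) _

  y+c<x+c+m : ∀ c x {y} → y < m → y + c < x + c + m
  y+c<x+c+m c x {y} y<m = subst (y + c <_) x+m+c≡x+c+m (+-monoˡ-< c (<-≤-trans y<m (m≤n+m m x)))
    where
    x+m+c≡x+c+m : x + m + c ≡ x + c + m
    x+m+c≡x+c+m = trans (+-assoc x m c) (trans (cong (x +_) (+-comm m c)) (sym (+-assoc x c m)))

  ⟦+⟧-injective : ∀ c {x y} → x < m → y < m → ⟦ x + c ⟧ ≡ ⟦ y + c ⟧ → x ≡ y
  ⟦+⟧-injective c {x} {y} x<m y<m eq with <-cmp x y
  ... | tri≈ _ x≡y _ = x≡y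
  ... | tri< x<y _ _ = contradiction (sym eq) (⟦⟧-window-≢ (+-monoˡ-< c x<y) (y+c<x+c+m c x y<m))
  ... | tri> _ _ y<x = contradiction eq (⟦⟧-window-≢ (+-monoˡ-< c y<x) (y+c<x+c+m c y x<m))

  cutsAt : List ℕ → EdgeSet G
  cutsAt cs e = does (toℕ e ∈? cs)

  cutsAt-∉ : ∀ cs e → cutsAt cs e ≡ false → toℕ e ∉ cs
  cutsAt-∉ cs e uncut e∈cs with trans (sym (dec-true (toℕ e ∈? cs) e∈cs)) uncut
  ... | ()

  antipode : ℕ → ℕ
  antipode t = (t + n) % m

  antipodes-multicut : ∀ t → t < m → IsMulticut G S (cutsAt (t ∷ antipode t ∷ []))
  antipodes-multicut t t<m with t <? n
  ... | yes t<n = antipodalPair-multicut _ t t<n (λ e uncut → subst (λ x → toℕ e ∉ t ∷ x ∷ []) t+n%m≡t+n (cutsAt-∉ _ e uncut))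
    where
    t+n%m≡t+n : (t + n) % m ≡ t + n
    t+n%m≡t+n = m<n⇒m%n≡m (subst (t + n <_) n+n≡m (+-monoˡ-< n t<n))
  ... | no t≮n = antipodalPair-multicut _ w w<n (λ e uncut → swap∉ (subst₂ (λ x y → toℕ e ∉ x ∷ y ∷ []) (sym w+n≡t) t+n%m≡w
                                                                         (cutsAt-∉ _ e uncut)))
    where
    w = t ∸ n
    w+n≡t : w + n ≡ t
    w+n≡t = m∸n+n≡m (≮⇒≥ t≮n)
    w<n : w < n
    w<n = +-cancelʳ-< n w n (subst₂ _<_ (sym w+n≡t) (sym n+n≡m) t<m)
    t+n%m≡w : (t + n) % m ≡ w
    t+n%m≡w = begin
      (t + n) % m        ≡⟨ cong (λ k → (k + n) % m) w+n≡t ⟨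
      (w + n + n) % m    ≡⟨ cong (_% m) (trans (+-assoc w n n) (cong (w +_) n+n≡m)) ⟩
      (w + m) % m        ≡⟨ [m+n]%n≡m%n w m ⟩
      w % m              ≡⟨ m<n⇒m%n≡m (<-trans w<n n<m) ⟩
      w                  ∎
      where open ≡-Reasoning
    swap∉ : ∀ {x a b} → x ∉ a ∷ b ∷ [] → x ∉ b ∷ a ∷ []
    swap∉ x∉ (here x≡b)         = x∉ (there (here x≡b))
    swap∉ x∉ (there (here x≡a)) = x∉ (here x≡a)

  antipode-%2 : ∀ t → antipode t % 2 ≢ t % 2
  antipode-%2 t eq = +n-flips-parity t (trans (sym (%m%2 (t + n))) eq)

module CoefficientVector (h : ℕ.ℕ) (hn : 5 ℕ.≤ ℕ.suc (2 ℕ.* h)) where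

  open Cycle h hn
  open FiniteSums using (Σᶠ-single)
  open import Data.Nat hiding (_≟_)
  open import Data.Nat.Properties hiding (_≟_)
  open import Data.Nat.DivMod
  open import Data.Fin using (Fin; toℕ; fromℕ<; zero; _≟_)
  open import Data.Fin.Properties using (toℕ-injective; toℕ-fromℕ<; toℕ<n)
  open import Data.Rational as ℚ using (0ℚ)
  import Data.Rational.Properties as ℚP
  open import Data.Nat.Solver using (module +-*-Solver)
  open +-*-Solver using (solve; _:+_; _:*_; _:=_; con)
  open import Data.Product using (∃; _×_; _,_)
  open import Data.Bool using (if_then_else_)
  open import Relation.Nullary using (yes; no; contradiction)
  open import Relation.Nullary.Decidable using (⌊_⌋)
  open import Relation.Binary.PropositionalEquality

  evenEdge : Fin n → Fin m
  evenEdge i = ⟦ 2 * toℕ i ⟧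

  oddEdge : Fin n → Fin m
  oddEdge i = ⟦ 2 * toℕ i + 2 * n ∸ 1 ⟧

  2*<m : ∀ (i : Fin n) → 2 * toℕ i < m
  2*<m i = *-monoʳ-< 2 (toℕ<n i)

  m∸1≡1+2h*2 : m ∸ 1 ≡ 1 + 2 * h * 2
  m∸1≡1+2h*2 = cong (_∸ 1) (solve 1 (λ h → con 2 :* (con 1 :+ con 2 :* h) := con 2 :+ con 2 :* h :* con 2) refl h)

  oddEdge-≡ : ∀ i → oddEdge i ≡ ⟦ 2 * toℕ i + (m ∸ 1) ⟧
  oddEdge-≡ i = cong ⟦_⟧ (+-∸-assoc (2 * toℕ i) {m} {1} (s≤s z≤n))

  evenEdge-%2 : ∀ i → toℕ (evenEdge i) % 2 ≡ 0
  evenEdge-%2 i = trans (toℕ-⟦⟧-%2 (2 * toℕ i)) (Parity.[r+2x]%2≡r%2 0 (toℕ i))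

  oddEdge-%2 : ∀ i → toℕ (oddEdge i) % 2 ≡ 1
  oddEdge-%2 i = begin
    toℕ (oddEdge i) % 2               ≡⟨ cong (λ e → toℕ e % 2) (oddEdge-≡ i) ⟩
    toℕ ⟦ 2 * toℕ i + (m ∸ 1) ⟧ % 2   ≡⟨ toℕ-⟦⟧-%2 (2 * toℕ i + (m ∸ 1)) ⟩
    (2 * toℕ i + (m ∸ 1)) % 2         ≡⟨ cong (λ k → (2 * toℕ i + k) % 2) m∸1≡1+2h*2 ⟩
    (2 * toℕ i + (1 + 2 * h * 2)) % 2 ≡⟨ cong (_% 2) (solve 2 (λ i h → con 2 :* i :+ (con 1 :+ con 2 :* h :* con 2)
                                                          := con 1 :+ con 2 :* (i :+ con 2 :* h)) refl (toℕ i) h) ⟩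
    (1 + 2 * (toℕ i + 2 * h)) % 2     ≡⟨ Parity.[r+2x]%2≡r%2 1 (toℕ i + 2 * h) ⟩
    1                                 ∎
    where open ≡-Reasoning

  evenEdge-injective : ∀ {i j} → evenEdge i ≡ evenEdge j → i ≡ j
  evenEdge-injective {i} {j} eq = toℕ-injective (*-cancelˡ-≡ (toℕ i) (toℕ j) 2 (⟦⟧-injective-< (2*<m i) (2*<m j) eq))

  oddEdge-injective : ∀ {i j} → oddEdge i ≡ oddEdge j → i ≡ j
  oddEdge-injective {i} {j} eq = toℕ-injective (*-cancelˡ-≡ (toℕ i) (toℕ j) 2
    (⟦+⟧-injective (m ∸ 1) (2*<m i) (2*<m j) (trans (sym (oddEdge-≡ i)) (trans eq (oddEdge-≡ j)))))

  halve : ∀ (e : Fin m) {r} → toℕ e % 2 ≡ r → ∃ λ x → x < n × toℕ e ≡ r + 2 * x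
  halve e {r} e%2 = toℕ e / 2 , x<n , e≡
    where
    e≡ : toℕ e ≡ r + 2 * (toℕ e / 2)
    e≡ = trans (m≡m%n+[m/n]*n (toℕ e) 2) (cong₂ _+_ e%2 (*-comm (toℕ e / 2) 2))
    x<n : toℕ e / 2 < n
    x<n = *-cancelˡ-< 2 (toℕ e / 2) n (≤-<-trans (subst (2 * (toℕ e / 2) ≤_) (sym e≡) (m≤n+m _ r)) (toℕ<n e))

  evenEdge-surjective : ∀ e → toℕ e % 2 ≡ 0 → ∃ λ i → evenEdge i ≡ e
  evenEdge-surjective e e%2 with halve e e%2
  ... | x , x<n , e≡2x = fromℕ< x<n , (begin
    ⟦ 2 * toℕ (fromℕ< x<n) ⟧   ≡⟨ cong (λ k → ⟦ 2 * k ⟧) (toℕ-fromℕ< x<n) ⟩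
    ⟦ 2 * x ⟧                  ≡⟨ cong ⟦_⟧ e≡2x ⟨
    ⟦ toℕ e ⟧                  ≡⟨ ⟦toℕ⟧ e ⟩
    e                          ∎)
    where open ≡-Reasoning

  oddEdge-surjective : ∀ e → toℕ e % 2 ≡ 1 → ∃ λ i → oddEdge i ≡ e
  oddEdge-surjective e e%2 with halve e e%2
  ... | x , x<n , e≡1+2x with suc x <? n
  ...   | yes 1+x<n = fromℕ< 1+x<n , (begin
    oddEdge (fromℕ< 1+x<n)          ≡⟨ oddEdge-≡ (fromℕ< 1+x<n) ⟩
    ⟦ 2 * toℕ (fromℕ< 1+x<n) + (m ∸ 1) ⟧ ≡⟨ cong (λ k → ⟦ 2 * k + (m ∸ 1) ⟧) (toℕ-fromℕ< 1+x<n) ⟩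
    ⟦ 2 * suc x + (m ∸ 1) ⟧         ≡⟨ cong ⟦_⟧ (wrap x) ⟩
    ⟦ 1 + 2 * x + m ⟧               ≡⟨ ⟦+m⟧ (1 + 2 * x) ⟩
    ⟦ 1 + 2 * x ⟧                   ≡⟨ cong ⟦_⟧ e≡1+2x ⟨
    ⟦ toℕ e ⟧                       ≡⟨ ⟦toℕ⟧ e ⟩
    e                               ∎)
    where
    open ≡-Reasoning
    wrap : ∀ x → 2 * suc x + (m ∸ 1) ≡ 1 + 2 * x + m
    wrap x = trans (cong (2 * suc x +_) m∸1≡1+2h*2)
      (solve 2 (λ x h → con 2 :* (con 1 :+ x) :+ (con 1 :+ con 2 :* h :* con 2)
                      := con 1 :+ con 2 :* x :+ con 2 :* (con 1 :+ con 2 :* h)) refl x h)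
  ...   | no 1+x≮n = zero , (begin
    oddEdge zero      ≡⟨ oddEdge-≡ zero ⟩
    ⟦ m ∸ 1 ⟧         ≡⟨ cong ⟦_⟧ (trans m∸1≡1+2h*2 (cong (λ k → 1 + k) (*-comm (2 * h) 2))) ⟩
    ⟦ 1 + 2 * (2 * h) ⟧ ≡⟨ cong (λ k → ⟦ 1 + 2 * k ⟧) x≡2h ⟨
    ⟦ 1 + 2 * x ⟧     ≡⟨ cong ⟦_⟧ e≡1+2x ⟨
    ⟦ toℕ e ⟧         ≡⟨ ⟦toℕ⟧ e ⟩
    e                 ∎)
    where
    open ≡-Reasoning
    x≡2h : x ≡ 2 * h
    x≡2h = suc-injective (≤-antisym x<n (≮⇒≥ 1+x≮n))

  if-≟-≡ : ∀ {e x : Fin m} c → e ≡ x → (if ⌊ e ≟ x ⌋ then c else 0ℚ) ≡ c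
  if-≟-≡ {e} {x} c e≡x with e ≟ x
  ... | yes _   = refl
  ... | no e≢x  = contradiction e≡x e≢x

  if-≟-≢ : ∀ {e x : Fin m} c → e ≢ x → (if ⌊ e ≟ x ⌋ then c else 0ℚ) ≡ 0ℚ
  if-≟-≢ {e} {x} c e≢x with e ≟ x
  ... | yes e≡x = contradiction e≡x e≢x
  ... | no _    = refl

  evenEdge≢oddEdge : ∀ i j → evenEdge i ≢ oddEdge j
  evenEdge≢oddEdge i j eq = 0≢1+n (trans (sym (evenEdge-%2 i)) (trans (cong (λ e → toℕ e % 2) eq) (oddEdge-%2 j)))

  coeffTerm : ℕ → ℕ → Fin m → Fin n → ℚ.ℚ
  coeffTerm β β′ e i = (if ⌊ e ≟ oddEdge i ⌋ then ℕ→ℚ β else 0ℚ) ℚ.+ (if ⌊ e ≟ evenEdge i ⌋ then ℕ→ℚ β′ else 0ℚ)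

  coeffs-evenEdge : ∀ β β′ e → toℕ e % 2 ≡ 0 → coeffs n hn β β′ e ≡ ℕ→ℚ β′
  coeffs-evenEdge β β′ e e%2 with evenEdge-surjective e e%2
  ... | i , refl = begin
    Σᶠ (coeffTerm β β′ (evenEdge i))    ≡⟨ Σᶠ-single (coeffTerm β β′ (evenEdge i)) i vanish ⟩
    coeffTerm β β′ (evenEdge i) i       ≡⟨ cong₂ ℚ._+_ (if-≟-≢ (ℕ→ℚ β) (evenEdge≢oddEdge i i))
                                                       (if-≟-≡ {evenEdge i} (ℕ→ℚ β′) refl) ⟩
    0ℚ ℚ.+ ℕ→ℚ β′                       ≡⟨ ℚP.+-identityˡ (ℕ→ℚ β′) ⟩
    ℕ→ℚ β′                              ∎
    where
    open ≡-Reasoning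
    vanish : ∀ j → j ≢ i → coeffTerm β β′ (evenEdge i) j ≡ 0ℚ
    vanish j j≢i = cong₂ ℚ._+_ (if-≟-≢ (ℕ→ℚ β) (evenEdge≢oddEdge i j))
                               (if-≟-≢ (ℕ→ℚ β′) (λ eq → j≢i (evenEdge-injective (sym eq))))

  coeffs-oddEdge : ∀ β β′ e → toℕ e % 2 ≡ 1 → coeffs n hn β β′ e ≡ ℕ→ℚ β
  coeffs-oddEdge β β′ e e%2 with oddEdge-surjective e e%2
  ... | i , refl = begin
    Σᶠ (coeffTerm β β′ (oddEdge i))     ≡⟨ Σᶠ-single (coeffTerm β β′ (oddEdge i)) i vanish ⟩
    coeffTerm β β′ (oddEdge i) i        ≡⟨ cong₂ ℚ._+_ (if-≟-≡ {oddEdge i} (ℕ→ℚ β) refl)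
                                                       (if-≟-≢ (ℕ→ℚ β′) (λ eq → evenEdge≢oddEdge i i (sym eq))) ⟩
    ℕ→ℚ β ℚ.+ 0ℚ                        ≡⟨ ℚP.+-identityʳ (ℕ→ℚ β) ⟩
    ℕ→ℚ β                               ∎
    where
    open ≡-Reasoning
    vanish : ∀ j → j ≢ i → coeffTerm β β′ (oddEdge i) j ≡ 0ℚ
    vanish j j≢i = cong₂ ℚ._+_ (if-≟-≢ (ℕ→ℚ β) (λ eq → j≢i (oddEdge-injective (sym eq))))
                               (if-≟-≢ (ℕ→ℚ β′) (λ eq → evenEdge≢oddEdge j i (sym eq)))

module Validity (h : ℕ.ℕ) (hn : 5 ℕ.≤ ℕ.suc (2 ℕ.* h)) (q : ℕ.ℕ) (q≤1 : q ℕ.≤ 1)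
                (a : Fin.Fin (Cycle.m h hn) → ℚ.ℚ)
                (cheap : ∀ e → Fin.toℕ e ℕ.% 2 ≡ q → a e ≡ ℚ.1ℚ)
                (expensive : ∀ e → Fin.toℕ e ℕ.% 2 ≡ 1 ℕ.∸ q → a e ≡ ℕ→ℚ 2) where

  open Cycle h hn
  open FiniteSums
  open LinearAlgebra using (·-mono-≤; convexCombination-≥)
  open import Data.Nat as ℕ using (ℕ; zero; suc; _∸_; _%_)
  open import Data.Nat.Properties as ℕ using (<-cmp)
  open import Data.Unit using (tt)
  open import Data.Fin using (Fin; toℕ; _≟_)
  open import Data.Fin.Properties using (any?)
  open import Data.Rational using (ℚ; 0ℚ; 1ℚ; _+_; _*_; _≤_)
  open import Data.Rational.Properties hiding (_≟_; <-cmp)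
  open import Data.Product using (_,_)
  open import Data.Sum using (_⊎_; inj₁; inj₂; swap)
  open import Data.Bool using (true; false)
  open import Data.Bool.Properties using (¬-not) renaming (_≟_ to _≟ᵇ_)
  open import Relation.Nullary using (¬_; yes; no; ¬?; contradiction)
  open import Relation.Nullary.Decidable using (_×-dec_)
  open import Relation.Binary.PropositionalEquality

  parity-split : ∀ x → x % 2 ≡ q ⊎ x % 2 ≡ 1 ∸ q
  parity-split = Parity.split q≤1

  1≤weight : ∀ e → 1ℚ ≤ a e
  1≤weight e with parity-split (toℕ e)
  ... | inj₁ e%2≡q   = ≤-reflexive (sym (cheap e e%2≡q))
  ... | inj₂ e%2≡1∸q = ≤-trans (≤ᵇ⇒≤ tt) (≤-reflexive (sym (expensive e e%2≡1∸q)))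

  0≤weight : ∀ e → 0ℚ ≤ a e
  0≤weight e = ≤-trans (≤ᵇ⇒≤ tt) (1≤weight e)

  cutWeight : EdgeSet G → Fin m → ℚ
  cutWeight δ e = a e * incidence G δ e

  0≤cutWeight : ∀ δ e → 0ℚ ≤ cutWeight δ e
  0≤cutWeight δ e with δ e
  ... | true  = ≤-trans (0≤weight e) (≤-reflexive (sym (*-identityʳ (a e))))
  ... | false = ≤-reflexive (sym (*-zeroʳ (a e)))

  cutWeight-cut : ∀ δ e → δ e ≡ true → cutWeight δ e ≡ a e
  cutWeight-cut δ e cut rewrite cut = *-identityʳ (a e)

  1≤cutWeight : ∀ δ e → δ e ≡ true → 1ℚ ≤ cutWeight δ e
  1≤cutWeight δ e cut = ≤-trans (1≤weight e) (≤-reflexive (sym (cutWeight-cut δ e cut)))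

  sameParity-cuts⇒¬multicut : ∀ {δ} → IsMulticut G S δ → ∀ j k → toℕ j % 2 ≡ toℕ k % 2 →
                              ¬ (∀ e → δ e ≡ true → e ≡ j ⊎ e ≡ k)
  sameParity-cuts⇒¬multicut mc j k j≡k with ℕ.≤-total (toℕ j) (toℕ k)
  ... | inj₁ j≤k = cuts⊆nonAntipodalPair⇒¬multicut mc j k j≤k (λ k≡j+n → +n-flips-parity (toℕ j)
                     (trans (cong (_% 2) (sym k≡j+n)) (sym j≡k)))
  ... | inj₂ k≤j = λ cuts⊆jk → cuts⊆nonAntipodalPair⇒¬multicut mc k j k≤j
                     (λ j≡k+n → +n-flips-parity (toℕ k) (trans (cong (_% 2) (sym j≡k+n)) j≡k))
                     (λ e cut → swap (cuts⊆jk e cut))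

  3≤expensive+cut : ∀ δ j k → δ j ≡ true → δ k ≡ true → j ≢ k → toℕ j % 2 ≡ 1 ∸ q →
                    ℕ→ℚ 3 ≤ a · incidence G δ
  3≤expensive+cut δ j k j-cut k-cut j≢k j-expensive = begin
    ℕ→ℚ 3                             ≤⟨ ≤ᵇ⇒≤ tt ⟩
    ℕ→ℚ 2 + 1ℚ                        ≤⟨ +-mono-≤ (≤-reflexive (sym (trans (cutWeight-cut δ j j-cut)
                                                                                   (expensive j j-expensive))))
                                                    (1≤cutWeight δ k k-cut) ⟩
    cutWeight δ j + cutWeight δ k     ≤⟨ two-terms≤Σᶠ j k j≢k (0≤cutWeight δ) ⟩
    a · incidence G δ                 ∎
    where open ≤-Reasoning

  3≤three-cuts : ∀ δ j k l → δ j ≡ true → δ k ≡ true → δ l ≡ true → j ≢ k → j ≢ l → k ≢ l →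
                 ℕ→ℚ 3 ≤ a · incidence G δ
  3≤three-cuts δ j k l j-cut k-cut l-cut j≢k j≢l k≢l = begin
    ℕ→ℚ 3                                           ≤⟨ ≤ᵇ⇒≤ tt ⟩
    1ℚ + (1ℚ + 1ℚ)                                  ≤⟨ +-mono-≤ (1≤cutWeight δ j j-cut)
                                                          (+-mono-≤ (1≤cutWeight δ k k-cut) (1≤cutWeight δ l l-cut)) ⟩
    cutWeight δ j + (cutWeight δ k + cutWeight δ l) ≤⟨ three-terms≤Σᶠ j k l j≢k j≢l k≢l (0≤cutWeight δ) ⟩
    a · incidence G δ                               ∎
    where open ≤-Reasoning

  multicut-weight≥3 : ∀ δ → IsMulticut G S δ → ℕ→ℚ 3 ≤ a · incidence G δ
  multicut-weight≥3 δ mc with any? (λ e → δ e ≟ᵇ true)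
  ... | no ¬cut = contradiction (λ e cut → contradiction (e , cut) ¬cut)
                                (sameParity-cuts⇒¬multicut mc Fin.zero Fin.zero refl)
  ... | yes (j , j-cut) with any? (λ e → ¬? (e ≟ j) ×-dec (δ e ≟ᵇ true))
  ...   | no ¬other = contradiction only-j (sameParity-cuts⇒¬multicut mc j j refl)
    where
    only-j : ∀ e → δ e ≡ true → e ≡ j ⊎ e ≡ j
    only-j e cut with e ≟ j
    ... | yes e≡j = inj₁ e≡j
    ... | no e≢j  = contradiction (e , e≢j , cut) ¬other
  ...   | yes (k , k≢j , k-cut) with parity-split (toℕ j) | parity-split (toℕ k)
  ...     | inj₂ j-expensive | _ = 3≤expensive+cut δ j k j-cut k-cut (λ j≡k → k≢j (sym j≡k)) j-expensive
  ...     | _ | inj₂ k-expensive = 3≤expensive+cut δ k j k-cut j-cut k≢j k-expensive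
  ...     | inj₁ j-cheap | inj₁ k-cheap with any? (λ e → ¬? (e ≟ j) ×-dec (¬? (e ≟ k) ×-dec (δ e ≟ᵇ true)))
  ...       | yes (l , l≢j , l≢k , l-cut) =
    3≤three-cuts δ j k l j-cut k-cut l-cut (λ j≡k → k≢j (sym j≡k)) (λ j≡l → l≢j (sym j≡l)) (λ k≡l → l≢k (sym k≡l))
  ...       | no ¬third = contradiction only-jk (sameParity-cuts⇒¬multicut mc j k (trans j-cheap (sym k-cheap)))
    where
    only-jk : ∀ e → δ e ≡ true → e ≡ j ⊎ e ≡ k
    only-jk e cut with e ≟ j | e ≟ k
    ... | yes e≡j | _        = inj₁ e≡j
    ... | no _    | yes e≡k  = inj₂ e≡k
    ... | no e≢j  | no e≢k   = contradiction (e , e≢j , e≢k , cut) ¬third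

  valid-polytope : Valid (MultCBox G S) a (ℕ→ℚ 3)
  valid-polytope x (k , λs , δs , λ≥0 , Σλ≡1 , multicuts , x≡) =
    subst (ℕ→ℚ 3 ≤_) (Σᶠ-cong (λ e → cong (a e *_) (sym (x≡ e))))
          (convexCombination-≥ a (ℕ→ℚ 3) λs (λ i → incidence G (δs i)) λ≥0 Σλ≡1
                               (λ i → multicut-weight≥3 (δs i) (multicuts i)))

  valid-dominant : Valid (MultC G S) a (ℕ→ℚ 3)
  valid-dominant x (y , y∈P , y≤x) = ≤-trans (valid-polytope y y∈P) (·-mono-≤ a 0≤weight y≤x)

module Facets (h : ℕ.ℕ) (hn : 5 ℕ.≤ ℕ.suc (2 ℕ.* h)) (q : ℕ.ℕ) (q≤1 : q ℕ.≤ 1)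
              (a : Fin.Fin (Cycle.m h hn) → ℚ.ℚ)
              (cheap : ∀ e → Fin.toℕ e ℕ.% 2 ≡ q → a e ≡ ℚ.1ℚ)
              (expensive : ∀ e → Fin.toℕ e ℕ.% 2 ≡ 1 ℕ.∸ q → a e ≡ ℕ→ℚ 2) where

  open Cycle h hn
  open import Function using (_∘_)
  open LinearAlgebra using (lincomb-·; triangular⇒affinelyIndependent; fullDimensional-facet)
  open Validity h hn q q≤1 a cheap expensive using (0≤weight; valid-polytope; valid-dominant)
  open FiniteSums using (Σᶠ-cong; Σᶠ-single; Σᶠ-pair; Σᶠ-triple; two-terms≤Σᶠ)
  open import Data.Nat
  open import Data.Nat.Properties
  open import Data.Nat.DivMod
  open import Data.Fin using (Fin; zero; suc; toℕ)
  open import Data.Fin.Properties using (toℕ-injective; toℕ<n; toℕ-fromℕ<)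
  import Data.Fin.Properties as FinP
  open import Data.Rational as ℚ using (ℚ; 0ℚ; 1ℚ)
  import Data.Rational.Properties as ℚP
  open import Algebra.Properties.Group ℚP.+-0-group using (x∙y⁻¹≈ε⇒x≈y)
  open import Data.Product using (_×_; _,_; ∃; ∃₂)
  open import Data.Unit using (⊤; tt)
  open import Data.Vec using (lookup)
  open SpecialTriples using (members; weights; 𝟙ᶠ[_∈_]; entry; entry-upper; entry-diagonal)
  open import Data.Sum using (inj₁; inj₂)
  open import Data.List using (List; []; _∷_; map)
  open import Data.List.Membership.Propositional using (_∈_; _∉_)
  open import Data.List.Membership.Propositional.Properties using (∈-map⁺; ∈-map⁻)
  open import Data.List.Membership.DecPropositional _≟_ using (_∈?_)
  open import Data.List.Relation.Unary.Any using (here; there)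
  open import Data.Bool using (true; if_then_else_)
  open import Relation.Nullary using (Dec; yes; no; does; contradiction)
  open import Relation.Nullary.Decidable using (dec-true; dec-false)
  open import Relation.Binary.PropositionalEquality
  open import Relation.Binary.Definitions using (tri<; tri≈; tri>)
  open import Data.Nat.Solver using (module +-*-Solver)
  open +-*-Solver using (solve; _:+_; _:*_; _:=_; con)

  p : ℕ
  p = 1 ∸ q

  p≤1 : p ≤ 1
  p≤1 = m∸n≤m 1 q

  cheapEdge : ℕ → ℕ
  cheapEdge x = q + 2 * x

  expensiveEdge : ℕ → ℕ
  expensiveEdge x = p + 2 * x

  r+2x<m : ∀ {r x} → r ≤ 1 → x < n → r + 2 * x < m
  r+2x<m {r} {x} r≤1 x<n = begin-strict
    r + 2 * x          <⟨ s≤s (+-monoˡ-≤ (2 * x) r≤1) ⟩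
    2 + 2 * x          ≡⟨ *-suc 2 x ⟨
    2 * suc x          ≤⟨ *-monoʳ-≤ 2 x<n ⟩
    m                  ∎
    where open ≤-Reasoning

  cheapEdge<m : ∀ {x} → x < n → cheapEdge x < m
  cheapEdge<m = r+2x<m q≤1

  expensiveEdge<m : ∀ {x} → x < n → expensiveEdge x < m
  expensiveEdge<m = r+2x<m p≤1

  r+2x%2 : ∀ {r} → r ≤ 1 → ∀ x → (r + 2 * x) % 2 ≡ r
  r+2x%2 {r} r≤1 x = trans (Parity.[r+2x]%2≡r%2 r x) (m<n⇒m%n≡m (s≤s r≤1))

  cheapEdge-%2 : ∀ x → cheapEdge x % 2 ≡ q
  cheapEdge-%2 = r+2x%2 q≤1

  expensiveEdge-%2 : ∀ x → expensiveEdge x % 2 ≡ p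
  expensiveEdge-%2 = r+2x%2 p≤1

  cheapEdge-injective : ∀ {x y} → cheapEdge x ≡ cheapEdge y → x ≡ y
  cheapEdge-injective {x} {y} eq = *-cancelˡ-≡ x y 2 (+-cancelˡ-≡ q (2 * x) (2 * y) eq)

  expensiveEdge-injective : ∀ {x y} → expensiveEdge x ≡ expensiveEdge y → x ≡ y
  expensiveEdge-injective {x} {y} eq = *-cancelˡ-≡ x y 2 (+-cancelˡ-≡ p (2 * x) (2 * y) eq)

  expensiveEdge≢cheapEdge : ∀ x y → expensiveEdge x ≢ cheapEdge y
  expensiveEdge≢cheapEdge x y eq = Parity.q≢1∸q q≤1
    (trans (sym (cheapEdge-%2 y)) (trans (cong (_% 2) (sym eq)) (expensiveEdge-%2 x)))

  antipodes : ℕ → List ℕ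
  antipodes x = expensiveEdge x ∷ antipode (expensiveEdge x) ∷ []

  antipode-cheap : ∀ x → antipode (expensiveEdge x) % 2 ≡ q
  antipode-cheap x with Parity.split q≤1 (antipode (expensiveEdge x))
  ... | inj₁ %2≡q   = %2≡q
  ... | inj₂ %2≡1∸q = contradiction (trans %2≡1∸q (sym (expensiveEdge-%2 x))) (antipode-%2 (expensiveEdge x))

  𝟙[_∈_] : ℕ → List ℕ → ℚ
  𝟙[ t ∈ cs ] = if does (t ∈? cs) then 1ℚ else 0ℚ

  𝟙-∈ : ∀ {t cs} → t ∈ cs → 𝟙[ t ∈ cs ] ≡ 1ℚ
  𝟙-∈ {t} {cs} t∈cs rewrite dec-true (t ∈? cs) t∈cs = refl

  𝟙-∉ : ∀ {t cs} → t ∉ cs → 𝟙[ t ∈ cs ] ≡ 0ℚ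
  𝟙-∉ {t} {cs} t∉cs rewrite dec-false (t ∈? cs) t∉cs = refl

  incidenceAt : List ℕ → Fin m → ℚ
  incidenceAt cs = incidence G (cutsAt cs)

  incidenceAt-⟦⟧ : ∀ {t} cs → t < m → incidenceAt cs ⟦ t ⟧ ≡ 𝟙[ t ∈ cs ]
  incidenceAt-⟦⟧ {t} cs t<m = cong 𝟙[_∈ cs ] (toℕ-⟦⟧-< t<m)

  toℕ-≢ : ∀ {e u} → e ≢ ⟦ u ⟧ → toℕ e ≢ u
  toℕ-≢ {e} e≢u refl = e≢u (sym (⟦toℕ⟧ e))

  unitAt : ℕ → Fin m → ℚ
  unitAt t = incidenceAt (t ∷ [])

  unitAt-· : ∀ {t} → t < m → (v : Fin m → ℚ) → unitAt t · v ≡ v ⟦ t ⟧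
  unitAt-· {t} t<m v = begin
    unitAt t · v                    ≡⟨ Σᶠ-single (λ e → unitAt t e ℚ.* v e) ⟦ t ⟧ off ⟩
    unitAt t ⟦ t ⟧ ℚ.* v ⟦ t ⟧      ≡⟨ cong (ℚ._* v ⟦ t ⟧) (trans (incidenceAt-⟦⟧ (t ∷ []) t<m)
                                                                (𝟙-∈ {t} {t ∷ []} (here refl))) ⟩
    1ℚ ℚ.* v ⟦ t ⟧                  ≡⟨ ℚP.*-identityˡ (v ⟦ t ⟧) ⟩
    v ⟦ t ⟧                         ∎
    where
    open ≡-Reasoning
    off : ∀ e → e ≢ ⟦ t ⟧ → unitAt t e ℚ.* v e ≡ 0ℚ
    off e e≢t = trans (cong (ℚ._* v e) (𝟙-∉ {toℕ e} {t ∷ []} λ { (here e≡t) → toℕ-≢ e≢t e≡t }))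
                      (ℚP.*-zeroˡ (v e))

  unitAt-·-incidenceAt : ∀ {t} cs → t < m → unitAt t · incidenceAt cs ≡ 𝟙[ t ∈ cs ]
  unitAt-·-incidenceAt cs t<m = trans (unitAt-· t<m (incidenceAt cs)) (incidenceAt-⟦⟧ cs t<m)

  cheapTriple : ℕ → ℕ → ℕ → List ℕ
  cheapTriple x y w = cheapEdge x ∷ cheapEdge y ∷ cheapEdge w ∷ []

  record Spread (x y w : ℕ) : Set where
    field
      x<y     : x < y
      y<w     : y < w
      w<n     : w < n
      y≤x+h   : y ≤ x + h
      w≤y+h   : w ≤ y + h
      n+x≤w+h : n + x ≤ w + h

  2h≤n : 2 * h ≤ n
  2h≤n = n≤1+n (2 * h)

  cheapEdge-gap : ∀ {x y} → y ≤ x + h → cheapEdge y ≤ cheapEdge x + n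
  cheapEdge-gap {x} {y} y≤x+h = begin
    q + 2 * y             ≤⟨ +-monoʳ-≤ q (*-monoʳ-≤ 2 y≤x+h) ⟩
    q + 2 * (x + h)       ≡⟨ solve 3 (λ q x h → q :+ con 2 :* (x :+ h) := q :+ con 2 :* x :+ con 2 :* h) refl q x h ⟩
    q + 2 * x + 2 * h     ≤⟨ +-monoʳ-≤ (q + 2 * x) 2h≤n ⟩
    q + 2 * x + n         ∎
    where open ≤-Reasoning

  cheapEdge-wrapGap : ∀ {x w} → n + x ≤ w + h → m + cheapEdge x ≤ cheapEdge w + n
  cheapEdge-wrapGap {x} {w} n+x≤w+h = begin
    2 * n + (q + 2 * x)   ≡⟨ solve 3 (λ n q x → con 2 :* n :+ (q :+ con 2 :* x) := q :+ con 2 :* (n :+ x)) refl n q x ⟩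
    q + 2 * (n + x)       ≤⟨ +-monoʳ-≤ q (*-monoʳ-≤ 2 n+x≤w+h) ⟩
    q + 2 * (w + h)       ≡⟨ solve 3 (λ q w h → q :+ con 2 :* (w :+ h) := q :+ con 2 :* w :+ con 2 :* h) refl q w h ⟩
    q + 2 * w + 2 * h     ≤⟨ +-monoʳ-≤ (q + 2 * w) 2h≤n ⟩
    q + 2 * w + n         ∎
    where open ≤-Reasoning

  cheapEdge-mono-< : ∀ {x y} → x < y → cheapEdge x < cheapEdge y
  cheapEdge-mono-< x<y = +-monoʳ-< q (*-monoʳ-< 2 x<y)

  cheapTriple-multicut : ∀ {x y w} → Spread x y w → IsMulticut G S (cutsAt (cheapTriple x y w))
  cheapTriple-multicut {x} {y} {w} spread =
    ThreeCuts.multicut (cheapEdge-mono-< x<y) (cheapEdge-mono-< y<w) (cheapEdge<m w<n)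
                       (cheapEdge-gap y≤x+h) (cheapEdge-gap w≤y+h) (cheapEdge-wrapGap n+x≤w+h)
                       _ (λ e uncut → cutsAt-∉ _ e uncut)
    where open Spread spread

  ⟦⟧-≢ : ∀ {u v} → u < m → v < m → u ≢ v → ⟦ u ⟧ ≢ ⟦ v ⟧
  ⟦⟧-≢ u<m v<m u≢v eq = u≢v (⟦⟧-injective-< u<m v<m eq)

  cheap-⟦⟧ : ∀ u → u % 2 ≡ q → a ⟦ u ⟧ ≡ 1ℚ
  cheap-⟦⟧ u u%2≡q = cheap ⟦ u ⟧ (trans (toℕ-⟦⟧-%2 u) u%2≡q)

  expensive-⟦⟧ : ∀ u → u % 2 ≡ p → a ⟦ u ⟧ ≡ ℕ→ℚ 2
  expensive-⟦⟧ u u%2≡p = expensive ⟦ u ⟧ (trans (toℕ-⟦⟧-%2 u) u%2≡p)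

  weighted-∈ : ∀ cs {u} → u < m → u ∈ cs → a ⟦ u ⟧ ℚ.* incidenceAt cs ⟦ u ⟧ ≡ a ⟦ u ⟧
  weighted-∈ cs {u} u<m u∈cs = trans (cong (a ⟦ u ⟧ ℚ.*_) (trans (incidenceAt-⟦⟧ cs u<m) (𝟙-∈ u∈cs))) (ℚP.*-identityʳ _)

  weighted-∉ : ∀ cs e → toℕ e ∉ cs → a e ℚ.* incidenceAt cs e ≡ 0ℚ
  weighted-∉ cs e e∉cs = trans (cong (a e ℚ.*_) (𝟙-∉ e∉cs)) (ℚP.*-zeroʳ (a e))

  weight-pair : ∀ {u v} → u < m → v < m → u ≢ v → a · incidenceAt (u ∷ v ∷ []) ≡ a ⟦ u ⟧ ℚ.+ a ⟦ v ⟧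
  weight-pair {u} {v} u<m v<m u≢v = trans
    (Σᶠ-pair _ ⟦ u ⟧ ⟦ v ⟧ (⟦⟧-≢ u<m v<m u≢v)
             (λ e e≢u e≢v → weighted-∉ cs e λ { (here eq) → toℕ-≢ e≢u eq ; (there (here eq)) → toℕ-≢ e≢v eq }))
    (cong₂ ℚ._+_ (weighted-∈ cs u<m (here refl)) (weighted-∈ cs v<m (there (here refl))))
    where cs = u ∷ v ∷ []

  weight-triple : ∀ {u v w} → u < m → v < m → w < m → u ≢ v → u ≢ w → v ≢ w →
                  a · incidenceAt (u ∷ v ∷ w ∷ []) ≡ a ⟦ u ⟧ ℚ.+ (a ⟦ v ⟧ ℚ.+ a ⟦ w ⟧)
  weight-triple {u} {v} {w} u<m v<m w<m u≢v u≢w v≢w = trans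
    (Σᶠ-triple _ ⟦ u ⟧ ⟦ v ⟧ ⟦ w ⟧ (⟦⟧-≢ u<m v<m u≢v) (⟦⟧-≢ u<m w<m u≢w) (⟦⟧-≢ v<m w<m v≢w)
               (λ e e≢u e≢v e≢w → weighted-∉ cs e λ { (here eq) → toℕ-≢ e≢u eq ; (there (here eq)) → toℕ-≢ e≢v eq
                                                   ; (there (there (here eq))) → toℕ-≢ e≢w eq }))
    (cong₂ ℚ._+_ (weighted-∈ cs u<m (here refl))
                 (cong₂ ℚ._+_ (weighted-∈ cs v<m (there (here refl))) (weighted-∈ cs w<m (there (there (here refl))))))
    where cs = u ∷ v ∷ w ∷ []

  antipodes-weight : ∀ x → x < n → a · incidenceAt (antipodes x) ≡ ℕ→ℚ 3
  antipodes-weight x x<n = begin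
    a · incidenceAt (t ∷ antipode t ∷ [])       ≡⟨ weight-pair (expensiveEdge<m x<n) (m%n<n (t + n) m) t≢antipode ⟩
    a ⟦ t ⟧ ℚ.+ a ⟦ antipode t ⟧          ≡⟨ cong₂ ℚ._+_ (expensive-⟦⟧ t (expensiveEdge-%2 x)) (cheap-⟦⟧ (antipode t) (antipode-cheap x)) ⟩
    ℕ→ℚ 3                                 ∎
    where
    open ≡-Reasoning
    t = expensiveEdge x
    t≢antipode : t ≢ antipode t
    t≢antipode eq = antipode-%2 t (cong (_% 2) (sym eq))

  cheapTriple-weight : ∀ {x y w} → Spread x y w → a · incidenceAt (cheapTriple x y w) ≡ ℕ→ℚ 3
  cheapTriple-weight {x} {y} {w} spread = begin
    a · incidenceAt (cheapTriple x y w)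
      ≡⟨ weight-triple (cheapEdge<m x<n) (cheapEdge<m y<n) (cheapEdge<m w<n) (<⇒≢ (cheapEdge-mono-< x<y))
                       (<⇒≢ (cheapEdge-mono-< (<-trans x<y y<w))) (<⇒≢ (cheapEdge-mono-< y<w)) ⟩
    a ⟦ cheapEdge x ⟧ ℚ.+ (a ⟦ cheapEdge y ⟧ ℚ.+ a ⟦ cheapEdge w ⟧)
      ≡⟨ cong₂ ℚ._+_ (cheap-⟦⟧ (cheapEdge x) (cheapEdge-%2 x))
                     (cong₂ ℚ._+_ (cheap-⟦⟧ (cheapEdge y) (cheapEdge-%2 y)) (cheap-⟦⟧ (cheapEdge w) (cheapEdge-%2 w))) ⟩
    ℕ→ℚ 3 ∎
    where
    open ≡-Reasoning
    open Spread spread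
    y<n = <-trans y<w w<n
    x<n = <-trans x<y y<n

  h≥2 : 2 ≤ h
  h≥2 = lower hn
    where
    lower : ∀ {h} → 5 ≤ suc (2 * h) → 2 ≤ h
    lower {0} (s≤s ())
    lower {1} (s≤s (s≤s (s≤s ())))
    lower {suc (suc h)} _ = s≤s (s≤s z≤n)

  0<h : 0 < h
  0<h = ≤-trans (s≤s z≤n) h≥2

  h<h+h : h < h + h
  h<h+h = m<m+n h 0<h

  1+h<h+h : suc h < h + h
  1+h<h+h = subst (_< h + h) (+-comm h 1) (+-monoʳ-< h h≥2)

  h+h<n : h + h < n
  h+h<n = s≤s (≤-reflexive (cong (h +_) (sym (+-identityʳ h))))

  specialIndex : ℕ → ℕ
  specialIndex 0               = 0
  specialIndex 1               = 1
  specialIndex 2               = h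
  specialIndex 3               = suc h
  specialIndex (suc (suc (suc (suc _)))) = h + h

  specialIndex-<-suc : ∀ k → suc k ≤ 4 → specialIndex k < specialIndex (suc k)
  specialIndex-<-suc 0 _ = s≤s z≤n
  specialIndex-<-suc 1 _ = h≥2
  specialIndex-<-suc 2 _ = n<1+n h
  specialIndex-<-suc 3 _ = 1+h<h+h
  specialIndex-<-suc (suc (suc (suc (suc _)))) (s≤s (s≤s (s≤s (s≤s ()))))

  ascending : ∀ (g : ℕ → ℕ) K → (∀ k → suc k ≤ K → g k < g (suc k)) → ∀ {i j} → i < j → j ≤ K → g i < g j
  ascending g K g-<-suc {i} {suc j} (s≤s i≤j) 1+j≤K with m≤n⇒m<n∨m≡n i≤j
  ... | inj₁ i<j = <-trans (ascending g K g-<-suc i<j (≤-trans (n≤1+n j) 1+j≤K)) (g-<-suc j 1+j≤K)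
  ... | inj₂ i≡j = subst (λ x → g x < g (suc j)) (sym i≡j) (g-<-suc j 1+j≤K)

  special : Fin 5 → ℕ
  special s = specialIndex (toℕ s)

  special-injective : ∀ {s t} → special s ≡ special t → s ≡ t
  special-injective {s} {t} eq with <-cmp (toℕ s) (toℕ t)
  ... | tri≈ _ s≡t _ = toℕ-injective s≡t
  ... | tri< s<t _ _ = contradiction eq (<⇒≢ (ascending specialIndex 4 specialIndex-<-suc s<t (≤-pred (toℕ<n t))))
  ... | tri> _ _ t<s = contradiction (sym eq) (<⇒≢ (ascending specialIndex 4 specialIndex-<-suc t<s (≤-pred (toℕ<n s))))

  n≡1+h+h : n ≡ suc (h + h)
  n≡1+h+h = cong suc (cong (h +_) (+-identityʳ h))

  spreadA : ∀ {k} → 1 ≤ k → k ≤ h → Spread 0 k (k + h)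
  spreadA {k} 1≤k k≤h = record
    { x<y = 1≤k ; y<w = m<m+n k 0<h ; w<n = ≤-<-trans (+-monoˡ-≤ h k≤h) h+h<n
    ; y≤x+h = k≤h ; w≤y+h = ≤-refl
    ; n+x≤w+h = begin
        n + 0          ≡⟨ +-identityʳ n ⟩
        n              ≡⟨ n≡1+h+h ⟩
        1 + (h + h)    ≤⟨ +-monoˡ-≤ (h + h) 1≤k ⟩
        k + (h + h)    ≡⟨ +-assoc k h h ⟨
        k + h + h      ∎ }
    where open ≤-Reasoning

  spreadC : ∀ {z} → 1 ≤ z → z < h → Spread z h (h + h)
  spreadC {z} 1≤z z<h = record
    { x<y = z<h ; y<w = h<h+h ; w<n = h+h<n ; y≤x+h = m≤n+m h z ; w≤y+h = ≤-refl
    ; n+x≤w+h = begin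
        n + z          ≡⟨ cong (_+ z) n≡1+h+h ⟩
        suc (h + h) + z ≡⟨ +-suc (h + h) z ⟨
        h + h + suc z  ≤⟨ +-monoʳ-≤ (h + h) z<h ⟩
        h + h + h      ∎ }
    where open ≤-Reasoning

  spreadD : Spread 1 (suc h) (h + h)
  spreadD = record
    { x<y = s≤s 0<h ; y<w = 1+h<h+h ; w<n = h+h<n
    ; y≤x+h = ≤-refl ; w≤y+h = n≤1+n (h + h)
    ; n+x≤w+h = begin
        n + 1          ≡⟨ cong (_+ 1) n≡1+h+h ⟩
        suc (h + h) + 1 ≡⟨ +-suc (h + h) 1 ⟨
        h + h + 2      ≤⟨ +-monoʳ-≤ (h + h) h≥2 ⟩
        h + h + h      ∎ }
    where open ≤-Reasoning

  spreadE : Spread 0 h (suc h)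
  spreadE = record
    { x<y = 0<h ; y<w = n<1+n h ; w<n = <-trans 1+h<h+h h+h<n
    ; y≤x+h = ≤-refl ; w≤y+h = <⇒≤ 1+h<h+h
    ; n+x≤w+h = ≤-reflexive (trans (+-identityʳ n) n≡1+h+h) }

  -- zeroTriple k and lastTriple z are used for 2 ≤ k, z < h; the special indices are 0, 1, h, h + 1, 2h,
  -- so the special triples are {0, 1, h+1}, {0, h, 2h}, {0, h, h+1}, {1, h, 2h} and {1, h+1, 2h}.
  data Triple : Set where
    zeroTriple lastTriple : ℕ → Triple
    specialTriple         : Fin 5 → Triple

  indices : Triple → List ℕ
  indices (zeroTriple k) = 0 ∷ k ∷ k + h ∷ []
  indices (lastTriple z) = z ∷ h ∷ h + h ∷ []
  indices (specialTriple t) = map special (lookup members t)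

  ValidTriple : Triple → Set
  ValidTriple (zeroTriple k) = 2 ≤ k × k < h
  ValidTriple (lastTriple z) = 2 ≤ z × z < h
  ValidTriple (specialTriple _) = ⊤

  data Cut : Set where
    allEdges  : Cut
    antipodal : ℕ → Cut
    triple    : Triple → Cut

  ValidCut : Cut → Set
  ValidCut allEdges      = ⊤
  ValidCut (antipodal x) = x < n
  ValidCut (triple T)    = ValidTriple T

  cutSet : Cut → EdgeSet G
  cutSet allEdges      _ = true
  cutSet (antipodal x)   = cutsAt (antipodes x)
  cutSet (triple T)      = cutsAt (map cheapEdge (indices T))

  vertex : Cut → Fin m → ℚ
  vertex K = incidence G (cutSet K)

  SpreadTriple : Triple → Set
  SpreadTriple T = ∃₂ λ x y → ∃ λ w → indices T ≡ x ∷ y ∷ w ∷ [] × Spread x y w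

  spread : ∀ T → ValidTriple T → SpreadTriple T
  spread (zeroTriple k) (2≤k , k<h) = _ , _ , _ , refl , spreadA (≤-trans (s≤s z≤n) 2≤k) (<⇒≤ k<h)
  spread (lastTriple z) (2≤z , z<h) = _ , _ , _ , refl , spreadC (≤-trans (s≤s z≤n) 2≤z) z<h
  spread (specialTriple zero) _                             = _ , _ , _ , refl , spreadA ≤-refl 0<h
  spread (specialTriple (suc zero)) _                       = _ , _ , _ , refl , spreadA 0<h ≤-refl
  spread (specialTriple (suc (suc zero))) _                 = _ , _ , _ , refl , spreadE
  spread (specialTriple (suc (suc (suc zero)))) _           = _ , _ , _ , refl , spreadC ≤-refl h≥2
  spread (specialTriple (suc (suc (suc (suc zero))))) _     = _ , _ , _ , refl , spreadD

  triple-multicut : ∀ T → ValidTriple T → IsMulticut G S (cutSet (triple T))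
  triple-multicut T valid with spread T valid
  ... | x , y , w , indices≡ , sp =
    subst (λ is → IsMulticut G S (cutsAt (map cheapEdge is))) (sym indices≡) (cheapTriple-multicut sp)

  triple-weight : ∀ T → ValidTriple T → a · vertex (triple T) ≡ ℕ→ℚ 3
  triple-weight T valid with spread T valid
  ... | x , y , w , indices≡ , sp =
    subst (λ is → a · incidenceAt (map cheapEdge is) ≡ ℕ→ℚ 3) (sym indices≡) (cheapTriple-weight sp)

  cut-multicut : ∀ K → ValidCut K → IsMulticut G S (cutSet K)
  cut-multicut allEdges      _   = antipodalPair-multicut _ 0 (s≤s z≤n) (λ e ())
  cut-multicut (antipodal x) x<n = antipodes-multicut (expensiveEdge x) (expensiveEdge<m x<n)
  cut-multicut (triple T)    valid = triple-multicut T valid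

  face-weight : ∀ K → ValidCut K → K ≢ allEdges → a · vertex K ≡ ℕ→ℚ 3
  face-weight allEdges      _     ≢all = contradiction refl ≢all
  face-weight (antipodal x) x<n   _    = antipodes-weight x x<n
  face-weight (triple T)    valid _    = triple-weight T valid

  -- On every other cut of equal or higher level, the functional of a cut takes the value offset
  -- (the weight 3 for allEdges, else 0); mostly it is the indicator of an edge private to the cut there.
  functional : Cut → Fin m → ℚ
  functional allEdges                    = a
  functional (antipodal x)               = unitAt (expensiveEdge x)
  functional (triple (zeroTriple k))     = unitAt (cheapEdge (k + h))
  functional (triple (lastTriple z))     = unitAt (cheapEdge z)
  functional (triple (specialTriple t))  = lincomb (lookup (lookup weights t)) (λ s → unitAt (cheapEdge (special s)))

  offset : Cut → ℚ
  offset allEdges = ℕ→ℚ 3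
  offset _        = 0ℚ

  tripleLevel : Triple → ℕ
  tripleLevel (zeroTriple _)    = 0
  tripleLevel (lastTriple _)    = 1
  tripleLevel (specialTriple t) = 2 + toℕ t

  level : Cut → ℕ
  level allEdges      = 0
  level (antipodal _) = 1
  level (triple T)    = 2 + tripleLevel T

  𝟙-cong : ∀ {P Q : Set} (p? : Dec P) (q? : Dec Q) → (P → Q) → (Q → P) →
           (if does p? then 1ℚ else 0ℚ) ≡ (if does q? then 1ℚ else 0ℚ)
  𝟙-cong (yes _) (yes _) _   _   = refl
  𝟙-cong (no _)  (no _)  _   _   = refl
  𝟙-cong (yes p) (no ¬q) p→q _   = contradiction (p→q p) ¬q
  𝟙-cong (no ¬p) (yes q) _   q→p = contradiction (q→p q) ¬p

  𝟙-cheapEdge : ∀ i is → 𝟙[ cheapEdge i ∈ map cheapEdge is ] ≡ 𝟙[ i ∈ is ]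
  𝟙-cheapEdge i is = 𝟙-cong (cheapEdge i ∈? map cheapEdge is) (i ∈? is)
    (λ mem → let (j , j∈is , eq) = ∈-map⁻ cheapEdge mem in subst (_∈ is) (sym (cheapEdge-injective eq)) j∈is)
    (∈-map⁺ cheapEdge)

  𝟙-special : ∀ s ts → 𝟙[ special s ∈ map special ts ] ≡ 𝟙ᶠ[ s ∈ ts ]
  𝟙-special s ts = 𝟙-cong (special s ∈? map special ts) (SpecialTriples._∈?_ s ts)
    (λ mem → let (t , t∈ts , eq) = ∈-map⁻ special mem in subst (_∈ ts) (sym (special-injective eq)) t∈ts)
    (∈-map⁺ special)

  special<n : ∀ s → special s < n
  special<n zero                             = s≤s z≤n
  special<n (suc zero)                       = <-trans h≥2 (<-trans h<h+h h+h<n)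
  special<n (suc (suc zero))                 = <-trans h<h+h h+h<n
  special<n (suc (suc (suc zero)))           = <-trans 1+h<h+h h+h<n
  special<n (suc (suc (suc (suc zero))))     = h+h<n

  cheapUnit-triple : ∀ {i} → i < n → ∀ T → unitAt (cheapEdge i) · vertex (triple T) ≡ 𝟙[ i ∈ indices T ]
  cheapUnit-triple {i} i<n T = trans (unitAt-·-incidenceAt (map cheapEdge (indices T)) (cheapEdge<m i<n)) (𝟙-cheapEdge i (indices T))

  specialFunctional-special : ∀ t t′ →
                              functional (triple (specialTriple t)) · vertex (triple (specialTriple t′)) ≡ entry t t′
  specialFunctional-special t t′ = trans
    (lincomb-· (lookup (lookup weights t)) (λ s → unitAt (cheapEdge (special s))) (vertex (triple (specialTriple t′))))
    (Σᶠ-cong (λ s → cong (lookup (lookup weights t) s ℚ.*_)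
                         (trans (cheapUnit-triple (special<n s) (specialTriple t′)) (𝟙-special s (lookup members t′)))))

  ∉-triple : ∀ {x u v w : ℕ} → x ≢ u → x ≢ v → x ≢ w → x ∉ u ∷ v ∷ w ∷ []
  ∉-triple x≢u _ _ (here x≡u)                 = x≢u x≡u
  ∉-triple _ x≢v _ (there (here x≡v))         = x≢v x≡v
  ∉-triple _ _ x≢w (there (there (here x≡w))) = x≢w x≡w

  ∉-specials : ∀ {x} → (∀ s → x ≢ special s) → ∀ ts → x ∉ map special ts
  ∉-specials x≢special ts mem = let (s , _ , x≡s) = ∈-map⁻ special mem in x≢special s x≡s

  zeroTriple-index-private : ∀ {k} → 2 ≤ k → k < h → ∀ T → ValidTriple T → T ≢ zeroTriple k → k + h ∉ indices T
  zeroTriple-index-private {k} 2≤k k<h (zeroTriple k′) (_ , k′<h) T≢k = ∉-triple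
    (>⇒≢ (<-≤-trans 0<h (m≤n+m h k)))
    (>⇒≢ (<-≤-trans k′<h (m≤n+m h k)))
    (λ k+h≡k′+h → T≢k (cong zeroTriple (sym (+-cancelʳ-≡ h k k′ k+h≡k′+h))))
  zeroTriple-index-private {k} 2≤k k<h (lastTriple z) (_ , z<h) _ = ∉-triple
    (>⇒≢ (<-≤-trans z<h (m≤n+m h k)))
    (>⇒≢ (m<n+m h (≤-trans (s≤s z≤n) 2≤k)))
    (<⇒≢ (+-monoˡ-< h k<h))
  zeroTriple-index-private {k} 2≤k k<h (specialTriple t) _ _ = ∉-specials not-special (lookup members t)
    where
    not-special : ∀ s → k + h ≢ special s
    not-special zero                     = >⇒≢ (<-≤-trans 0<h (m≤n+m h k))
    not-special (suc zero)               = >⇒≢ (<-≤-trans h≥2 (m≤n+m h k))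
    not-special (suc (suc zero))         = >⇒≢ (m<n+m h (≤-trans (s≤s z≤n) 2≤k))
    not-special (suc (suc (suc zero)))   = >⇒≢ (+-monoˡ-< h 2≤k)
    not-special (suc (suc (suc (suc zero)))) = <⇒≢ (+-monoˡ-< h k<h)

  lastTriple-index-private : ∀ {z} → 2 ≤ z → z < h → ∀ T → ValidTriple T → level (triple (lastTriple z)) ≤ level (triple T) →
                             T ≢ lastTriple z → z ∉ indices T
  lastTriple-index-private 2≤z z<h (zeroTriple _) _ (s≤s (s≤s ())) _
  lastTriple-index-private {z} 2≤z z<h (lastTriple z′) _ _ T≢z =
    ∉-triple (λ z≡z′ → T≢z (cong lastTriple (sym z≡z′))) (<⇒≢ z<h) (<⇒≢ (<-trans z<h h<h+h))
  lastTriple-index-private {z} 2≤z z<h (specialTriple t) _ _ _ = ∉-specials not-special (lookup members t)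
    where
    not-special : ∀ s → z ≢ special s
    not-special zero                     = >⇒≢ (≤-trans (s≤s z≤n) 2≤z)
    not-special (suc zero)               = >⇒≢ 2≤z
    not-special (suc (suc zero))         = <⇒≢ z<h
    not-special (suc (suc (suc zero)))   = <⇒≢ (<-trans z<h (n<1+n h))
    not-special (suc (suc (suc (suc zero)))) = <⇒≢ (<-trans z<h h<h+h)

  antipodalUnit-vanishes : ∀ {x} → x < n → ∀ K′ → ValidCut K′ → K′ ≢ antipodal x → 1 ≤ level K′ →
                           unitAt (expensiveEdge x) · vertex K′ ≡ 0ℚ
  antipodalUnit-vanishes {x} x<n (antipodal x′) _ K′≢ _ =
    trans (unitAt-·-incidenceAt (antipodes x′) (expensiveEdge<m x<n)) (𝟙-∉ {expensiveEdge x} {antipodes x′} λ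
      { (here eq)         → K′≢ (cong antipodal (sym (expensiveEdge-injective eq)))
      ; (there (here eq)) → Parity.q≢1∸q q≤1
                              (trans (sym (antipode-cheap x′)) (trans (cong (_% 2) (sym eq)) (expensiveEdge-%2 x))) })
  antipodalUnit-vanishes {x} x<n (triple T) _ _ _ =
    trans (unitAt-·-incidenceAt (map cheapEdge (indices T)) (expensiveEdge<m x<n)) (𝟙-∉ {cs = map cheapEdge (indices T)} λ mem →
      let (i , _ , eq) = ∈-map⁻ cheapEdge mem in expensiveEdge≢cheapEdge x i eq)

  functional-upper : ∀ K K′ → ValidCut K → ValidCut K′ → K′ ≢ K → level K ≤ level K′ →
                     functional K · vertex K′ ≡ offset K
  functional-upper allEdges      K′ _   valid′ K′≢ _   = face-weight K′ valid′ K′≢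
  functional-upper (antipodal x) K′ x<n valid′ K′≢ lvl = antipodalUnit-vanishes x<n K′ valid′ K′≢ lvl
  functional-upper (triple _) allEdges      _ _ _ ()
  functional-upper (triple _) (antipodal _) _ _ _ (s≤s ())
  functional-upper (triple (zeroTriple k)) (triple T′) (2≤k , k<h) valid′ K′≢ _ =
    trans (cheapUnit-triple (≤-<-trans (+-monoˡ-≤ h (<⇒≤ k<h)) h+h<n) T′)
          (𝟙-∉ (zeroTriple-index-private 2≤k k<h T′ valid′ (λ T′≡ → K′≢ (cong triple T′≡))))
  functional-upper (triple (lastTriple z)) (triple T′) (2≤z , z<h) valid′ K′≢ lvl =
    trans (cheapUnit-triple (<-trans z<h (<-trans h<h+h h+h<n)) T′)
          (𝟙-∉ (lastTriple-index-private 2≤z z<h T′ valid′ lvl (λ T′≡ → K′≢ (cong triple T′≡))))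
  functional-upper (triple (specialTriple _)) (triple (zeroTriple _)) _ _ _ (s≤s (s≤s ()))
  functional-upper (triple (specialTriple _)) (triple (lastTriple _)) _ _ _ (s≤s (s≤s (s≤s ())))
  functional-upper (triple (specialTriple t)) (triple (specialTriple t′)) _ _ K′≢ lvl =
    trans (specialFunctional-special t t′)
          (entry-upper t t′ (≤∧≢⇒< (+-cancelˡ-≤ 4 (toℕ t) (toℕ t′) lvl)
                                   (λ t≡t′ → K′≢ (cong (triple ∘ specialTriple) (toℕ-injective (sym t≡t′))))))

  allEdges-weight≥4 : ℕ→ℚ 4 ℚ.≤ a · vertex allEdges
  allEdges-weight≥4 = begin
    ℕ→ℚ 4                                             ≡⟨ cong₂ ℚ._+_ (expensive-⟦⟧ e₀ (expensiveEdge-%2 0))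
                                                                    (expensive-⟦⟧ e₁ (expensiveEdge-%2 1)) ⟨
    a ⟦ e₀ ⟧ ℚ.+ a ⟦ e₁ ⟧                             ≡⟨ cong₂ ℚ._+_ (ℚP.*-identityʳ (a ⟦ e₀ ⟧)) (ℚP.*-identityʳ (a ⟦ e₁ ⟧)) ⟨
    a ⟦ e₀ ⟧ ℚ.* 1ℚ ℚ.+ a ⟦ e₁ ⟧ ℚ.* 1ℚ               ≤⟨ two-terms≤Σᶠ ⟦ e₀ ⟧ ⟦ e₁ ⟧ e₀≢e₁
                                                           (λ e → ℚP.≤-trans (0≤weight e) (ℚP.≤-reflexive (sym (ℚP.*-identityʳ (a e))))) ⟩
    a · vertex allEdges                               ∎
    where
    open ℚP.≤-Reasoning
    e₀ = expensiveEdge 0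
    e₁ = expensiveEdge 1
    e₀≢e₁ : ⟦ e₀ ⟧ ≢ ⟦ e₁ ⟧
    e₀≢e₁ = ⟦⟧-≢ (expensiveEdge<m (s≤s z≤n)) (expensiveEdge<m (<-trans h≥2 (<-trans h<h+h h+h<n)))
                 (λ eq → 0≢1+n (expensiveEdge-injective {0} {1} eq))

  x-0≢0 : ∀ {x} → x ≢ 0ℚ → x ℚ.- 0ℚ ≢ 0ℚ
  x-0≢0 {x} x≢0 eq = x≢0 (trans (sym (ℚP.+-identityʳ x)) eq)

  functional-diagonal : ∀ K → ValidCut K → functional K · vertex K ℚ.- offset K ≢ 0ℚ
  functional-diagonal allEdges _ eq =
    ℚP.≤⇒≤ᵇ (subst (ℕ→ℚ 4 ℚ.≤_) (x∙y⁻¹≈ε⇒x≈y (a · vertex allEdges) (ℕ→ℚ 3) eq) allEdges-weight≥4)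
  functional-diagonal (antipodal x) x<n = x-0≢0 (λ eq → ℚP.1≢0 (trans (sym one) eq))
    where
    one : unitAt (expensiveEdge x) · vertex (antipodal x) ≡ 1ℚ
    one = trans (unitAt-·-incidenceAt (antipodes x) (expensiveEdge<m x<n)) (𝟙-∈ {expensiveEdge x} {antipodes x} (here refl))
  functional-diagonal (triple (zeroTriple k)) (_ , k<h) = x-0≢0 (λ eq → ℚP.1≢0 (trans (sym one) eq))
    where
    one : unitAt (cheapEdge (k + h)) · vertex (triple (zeroTriple k)) ≡ 1ℚ
    one = trans (cheapUnit-triple (≤-<-trans (+-monoˡ-≤ h (<⇒≤ k<h)) h+h<n) (zeroTriple k))
                (𝟙-∈ {k + h} {indices (zeroTriple k)} (there (there (here refl))))
  functional-diagonal (triple (lastTriple z)) (_ , z<h) = x-0≢0 (λ eq → ℚP.1≢0 (trans (sym one) eq))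
    where
    one : unitAt (cheapEdge z) · vertex (triple (lastTriple z)) ≡ 1ℚ
    one = trans (cheapUnit-triple (<-trans z<h (<-trans h<h+h h+h<n)) (lastTriple z))
                (𝟙-∈ {z} {indices (lastTriple z)} (here refl))
  functional-diagonal (triple (specialTriple t)) _ =
    x-0≢0 (λ eq → entry-diagonal t (trans (sym (specialFunctional-special t t)) eq))

  g : ℕ
  g = h ∸ 2

  2+g≡h : 2 + g ≡ h
  2+g≡h = m+[n∸m]≡n h≥2

  n≡g+g+5 : n ≡ g + g + 5
  n≡g+g+5 = begin
    suc (2 * h)           ≡⟨ cong (λ k → suc (2 * k)) 2+g≡h ⟨
    suc (2 * (2 + g))     ≡⟨ solve 1 (λ g → con 1 :+ con 2 :* (con 2 :+ g) := g :+ g :+ con 5) refl g ⟩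
    g + g + 5             ∎
    where open ≡-Reasoning

  2+<h : ∀ {t} → t < g → 2 + t < h
  2+<h t<g = subst (2 + _ <_) 2+g≡h (+-monoʳ-< 2 t<g)

  decodeTriple : ℕ → Triple
  decodeTriple t with t <? g
  ... | yes _ = zeroTriple (2 + t)
  ... | no _ with t ∸ g <? g
  ...   | yes _ = lastTriple (2 + (t ∸ g))
  ...   | no _  = specialTriple ((t ∸ g ∸ g) mod 5)

  encodeTriple : Triple → ℕ
  encodeTriple (zeroTriple k)    = k ∸ 2
  encodeTriple (lastTriple z)    = g + (z ∸ 2)
  encodeTriple (specialTriple t) = g + g + toℕ t

  decodeTriple-valid : ∀ t → ValidTriple (decodeTriple t)
  decodeTriple-valid t with t <? g
  ... | yes t<g = s≤s (s≤s z≤n) , 2+<h t<g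
  ... | no _ with t ∸ g <? g
  ...   | yes t-g<g = s≤s (s≤s z≤n) , 2+<h t-g<g
  ...   | no _      = tt

  encodeTriple-decodeTriple : ∀ t → t < n → encodeTriple (decodeTriple t) ≡ t
  encodeTriple-decodeTriple t t<n with t <? g
  ... | yes _ = refl
  ... | no t≮g with t ∸ g <? g
  ...   | yes _ = m+[n∸m]≡n (≮⇒≥ t≮g)
  ...   | no t-g≮g = begin
    g + g + toℕ ((t ∸ g ∸ g) mod 5)   ≡⟨ cong (g + g +_) (toℕ-fromℕ< (m%n<n (t ∸ g ∸ g) 5)) ⟩
    g + g + (t ∸ g ∸ g) % 5           ≡⟨ cong (g + g +_) (m<n⇒m%n≡m r<5) ⟩
    g + g + (t ∸ g ∸ g)               ≡⟨ cong (g + g +_) (∸-+-assoc t g g) ⟩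
    g + g + (t ∸ (g + g))             ≡⟨ m+[n∸m]≡n g+g≤t ⟩
    t                                 ∎
    where
    open ≡-Reasoning
    g+g≤t : g + g ≤ t
    g+g≤t = ≤-trans (+-monoʳ-≤ g (≮⇒≥ t-g≮g)) (≤-reflexive (m+[n∸m]≡n (≮⇒≥ t≮g)))
    r<5 : t ∸ g ∸ g < 5
    r<5 = subst (_< 5) (sym (∸-+-assoc t g g))
            (+-cancelˡ-< (g + g) (t ∸ (g + g)) 5 (subst (_< g + g + 5) (sym (m+[n∸m]≡n g+g≤t)) (subst (t <_) n≡g+g+5 t<n)))

  decode : ℕ → Cut
  decode zero = allEdges
  decode (suc j) with j <? n
  ... | yes _ = antipodal j
  ... | no _  = triple (decodeTriple (j ∸ n))

  encode : Cut → ℕ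
  encode allEdges      = 0
  encode (antipodal x) = suc x
  encode (triple T)    = suc (n + encodeTriple T)

  decode-valid : ∀ j → ValidCut (decode j)
  decode-valid zero = tt
  decode-valid (suc j) with j <? n
  ... | yes j<n = j<n
  ... | no _    = decodeTriple-valid (j ∸ n)

  encode-decode : ∀ j → j < suc m → encode (decode j) ≡ j
  encode-decode zero _ = refl
  encode-decode (suc j) (s≤s j<m) with j <? n
  ... | yes _   = refl
  ... | no j≮n  = cong suc (trans (cong (n +_) (encodeTriple-decodeTriple (j ∸ n) j-n<n)) (m+[n∸m]≡n (≮⇒≥ j≮n)))
    where
    j-n<n : j ∸ n < n
    j-n<n = +-cancelˡ-< n (j ∸ n) n (subst₂ _<_ (sym (m+[n∸m]≡n (≮⇒≥ j≮n))) (sym n+n≡m) j<m)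

  cutAt : Fin (suc m) → Cut
  cutAt i = decode (toℕ i)

  cutAt-injective : ∀ {i j} → cutAt i ≡ cutAt j → i ≡ j
  cutAt-injective {i} {j} eq = toℕ-injective (begin
    toℕ i                  ≡⟨ encode-decode (toℕ i) (toℕ<n i) ⟨
    encode (cutAt i)       ≡⟨ cong encode eq ⟩
    encode (cutAt j)       ≡⟨ encode-decode (toℕ j) (toℕ<n j) ⟩
    toℕ j                  ∎)
    where open ≡-Reasoning

  faceCutAt : Fin m → Cut
  faceCutAt j = cutAt (suc j)

  faceCutAt-valid : ∀ j → ValidCut (faceCutAt j)
  faceCutAt-valid j = decode-valid (suc (toℕ j))

  faceCutAt-≢allEdges : ∀ j → faceCutAt j ≢ allEdges
  faceCutAt-≢allEdges j eq = 0≢1+n (trans (cong encode (sym eq)) (encode-decode (suc (toℕ j)) (s≤s (toℕ<n j))))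

  triangular-family : ∀ {k} (ι : Fin k → Cut) → (∀ i → ValidCut (ι i)) → (∀ {i j} → ι i ≡ ι j → i ≡ j) →
                      AffinelyIndependent (vertex ∘ ι)
  triangular-family ι valid injective =
    triangular⇒affinelyIndependent (vertex ∘ ι) (functional ∘ ι) (offset ∘ ι) (level ∘ ι)
      (λ i → functional-diagonal (ι i) (valid i))
      (λ i j j≢i → functional-upper (ι i) (ι j) (valid i) (valid j) (λ eq → j≢i (injective eq)))

  multicut-∈-polytope : ∀ δ → IsMulticut G S δ → MultCBox G S (incidence G δ)
  multicut-∈-polytope δ multicut =
    1 , (λ _ → 1ℚ) , (λ _ → δ) , (λ _ → ℚP.≤ᵇ⇒≤ tt) , refl , (λ _ → multicut) ,
    (λ e → sym (trans (ℚP.+-identityʳ _) (ℚP.*-identityˡ _)))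

  vertex-∈-polytope : ∀ K → ValidCut K → MultCBox G S (vertex K)
  vertex-∈-polytope K valid = multicut-∈-polytope (cutSet K) (cut-multicut K valid)

  vertex-∈-dominant : ∀ K → ValidCut K → MultC G S (vertex K)
  vertex-∈-dominant K valid = vertex K , vertex-∈-polytope K valid , (λ _ → ℚP.≤-refl)

  sharedFacet : SharedFacet G S a (ℕ→ℚ 3)
  sharedFacet = facet (MultC G S) valid-dominant vertex-∈-dominant
              , facet (MultCBox G S) valid-polytope vertex-∈-polytope
    where
    allCuts-independent : AffinelyIndependent (vertex ∘ cutAt)
    allCuts-independent = triangular-family cutAt (λ i → decode-valid (toℕ i)) cutAt-injective
    faceCuts-independent : AffinelyIndependent (vertex ∘ faceCutAt)
    faceCuts-independent =
      triangular-family faceCutAt faceCutAt-valid (λ eq → FinP.suc-injective (cutAt-injective eq))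
    facet : ∀ P → Valid P a (ℕ→ℚ 3) → (∀ K → ValidCut K → P (vertex K)) → FacetDefining P a (ℕ→ℚ 3)
    facet P valid vertex-∈ = fullDimensional-facet P a (ℕ→ℚ 3) valid (λ ())
      (vertex ∘ cutAt) (λ i → vertex-∈ (cutAt i) (decode-valid (toℕ i))) allCuts-independent
      (vertex ∘ faceCutAt)
      (λ j → vertex-∈ (faceCutAt j) (faceCutAt-valid j)
           , face-weight (faceCutAt j) (faceCutAt-valid j) (faceCutAt-≢allEdges j))
      faceCuts-independent

open import Data.Nat using (ℕ; _≤_; _∸_; suc; _*_; z≤n; s≤s)
open import Data.Product using (_,_)
open import Data.Sum using (_⊎_; inj₁; inj₂)
open import Relation.Binary.PropositionalEquality using (refl)

theorem7p3 : (n : ℕ) → (hn : 5 ≤ n) → Odd n → (β : ℕ) → (β ≡ 1 ⊎ β ≡ 2) →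
    SharedFacet (C n hn) (Sᶜ n hn) (coeffs n hn β (3 ∸ β)) (ℕ→ℚ 3)
theorem7p3 .(suc (2 * h)) hn (h , refl) .1 (inj₁ refl) =
  Facets.sharedFacet h hn 1 (s≤s z≤n) (coeffs _ hn 1 2) (coeffs-oddEdge 1 2) (coeffs-evenEdge 1 2)
  where open CoefficientVector h hn
theorem7p3 .(suc (2 * h)) hn (h , refl) .2 (inj₂ refl) =
  Facets.sharedFacet h hn 0 z≤n (coeffs _ hn 2 1) (coeffs-evenEdge 2 1) (coeffs-oddEdge 2 1)
  where open CoefficientVector h hn
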